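{- Let $q$ be a prime power, let $m,k$ be positive integers and let $s\in\{1,\ldots,m\}$ with $\gcd(s,m)=1$. Let $S,T\subseteq\mathbb{F}_{q^m}$ be $\mathbb{F}_q$-subspaces with $\dim_{\mathbb{F}_q}(S)=\dim_{\mathbb{F}_q}(T)>k$. Then the $q$-systems $G_{k,s,m}[S]$ and $G_{k,s,m}[T]$ are equivalent if and only if there exists $\alpha\in\mathbb{F}_{q^m}^*$ such that $T=\alpha S$. In particular, when $m>k$ (so that $S=T=\mathbb{F}_{q^m}$ satisfies the hypothesis), \[ \mathrm{stab}_{\mathrm{GL}(k,q^m)}(G_{k,s,m})=\left\{\mathrm{diag}\big(d,d^{q^s},d^{q^{2s}},\ldots,d^{q^{s(k-1)}}\big)\,:\,d\in\mathbb{F}_{q^m}^*\right\}. \]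
   Context: For an $\mathbb{F}_q$-subspace $S\subseteq\mathbb{F}_{q^m}$, the Gabidulin system is $G_{k,s,m}[S]=\{(x,x^{q^s},\ldots,x^{q^{s(k-1)}}):x\in S\}\subseteq\mathbb{F}_{q^m}^k$, an $\mathbb{F}_q$-subspace, and $G_{k,s,m}:=G_{k,s,m}[\mathbb{F}_{q^m}]$. Elements of $\mathbb{F}_{q^m}^k$ are treated as column vectors when multiplied by matrices. Two such $\mathbb{F}_q$-subspaces $\mathcal{U},\mathcal{V}\subseteq\mathbb{F}_{q^m}^k$ are equivalent if there is $A\in\mathrm{GL}(k,q^m)$ with $A\mathcal{U}=\{Au:u\in\mathcal{U}\}=\mathcal{V}$; the stabilizer $\mathrm{stab}_{\mathrm{GL}(k,q^m)}(\mathcal{U})$ is the set of $A\in\mathrm{GL}(k,q^m)$ with $A\mathcal{U}=\mathcal{U}$. -}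

module Defs where

open import Level using (0ℓ)
open import Data.Nat as ℕ using (ℕ; zero; suc; _<_; _≤_)
open import Data.Nat.Primality using (Prime)
open import Data.Fin using (Fin; toℕ; _≟_)
import Data.Fin as Fin
open import Data.Unit using (⊤)
open import Relation.Nullary using (yes; no)
open import Data.Product using (Σ; ∃; ∃-syntax; _×_; _,_)
open import Relation.Binary.PropositionalEquality using (_≡_)
open import Relation.Nullary using (¬_)
open import Relation.Binary using (Decidable)
open import Function using (_⇔_)
open import Algebra.Core using (Op₁; Op₂)
import Algebra.Structures as AS

IsPrimePower : ℕ → Set
IsPrimePower q = ∃[ p ] ∃[ e ] (Prime p × 1 ≤ e × q ≡ p ℕ.^ e)

record FiniteField : Set₁ where
  field
    Carrier : Set
    _+_ _*_ : Op₂ Carrier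
    -_      : Op₁ Carrier
    0# 1#   : Carrier
    isCommutativeRing : AS.IsCommutativeRing _≡_ _+_ _*_ -_ 0# 1#
    0≢1     : ¬ (0# ≡ 1#)
    inverse : ∀ x → ¬ (x ≡ 0#) → ∃[ y ] (x * y ≡ 1#)
    size    : ℕ
    enum    : Fin size → Carrier
    enum-injective  : ∀ i j → enum i ≡ enum j → i ≡ j
    enum-surjective : ∀ x → ∃[ i ] (enum i ≡ x)

module _ (F : FiniteField) where
  open FiniteField F

  pow : Carrier → ℕ → Carrier
  pow x zero    = 1#
  pow x (suc n) = x * pow x n

  sumF : (n : ℕ) → (Fin n → Carrier) → Carrier
  sumF zero    f = 0#
  sumF (suc n) f = f Fin.zero + sumF n (λ i → f (Fin.suc i))

  -- the subfield F_q of F = F_{q^m}: elements with c^q = c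
  InFq : ℕ → Carrier → Set
  InFq q c = pow c q ≡ c

  record IsFqSubspace (q : ℕ) (S : Carrier → Set) : Set where
    field
      zero-mem : S 0#
      +-mem    : ∀ {x y} → S x → S y → S (x + y)
      ·-mem    : ∀ {c x} → InFq q c → S x → S (c * x)

  HasFqDim : ℕ → (Carrier → Set) → ℕ → Set
  HasFqDim q S n = Σ (Fin n → Carrier) λ v →
      (∀ i → S (v i))
    × (∀ (c : Fin n → Carrier) → (∀ i → InFq q (c i))
         → sumF n (λ i → c i * v i) ≡ 0# → ∀ i → c i ≡ 0#)
    × (∀ x → S x → Σ (Fin n → Carrier) λ c → ((∀ i → InFq q (c i)) × x ≡ sumF n (λ i → c i * v i)))

  Vec : ℕ → Set
  Vec k = Fin k → Carrier

  Mat : ℕ → Set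
  Mat k = Fin k → Fin k → Carrier

  _≐_ : ∀ {k} → Vec k → Vec k → Set
  u ≐ v = ∀ i → u i ≡ v i

  _≐M_ : ∀ {k} → Mat k → Mat k → Set
  A ≐M B = ∀ i j → A i j ≡ B i j

  _·v_ : ∀ {k} → Mat k → Vec k → Vec k
  _·v_ {k} A u i = sumF k (λ j → A i j * u j)

  _·M_ : ∀ {k} → Mat k → Mat k → Mat k
  _·M_ {k} A B i j = sumF k (λ l → A i l * B l j)

  idM : ∀ {k} → Mat k
  idM i j with i ≟ j
  ... | yes _ = 1#
  ... | no _  = 0#

  IsInvertible : ∀ {k} → Mat k → Set
  IsInvertible {k} A = ∃[ B ] ((A ·M B) ≐M idM × (B ·M A) ≐M idM)

  MapsOnto : ∀ {k} → Mat k → (Vec k → Set) → (Vec k → Set) → Set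
  MapsOnto {k} A U V = ∀ (v : Vec k) → V v ⇔ (∃[ u ] (U u × (A ·v u) ≐ v))

  Equivalent : ∀ {k} → (Vec k → Set) → (Vec k → Set) → Set
  Equivalent {k} U V = ∃[ A ] (IsInvertible A × MapsOnto A U V)

  InStab : ∀ {k} → (Vec k → Set) → Mat k → Set
  InStab U A = IsInvertible A × MapsOnto A U U

  Gab : (q k s : ℕ) → (Carrier → Set) → Vec k → Set
  Gab q k s S u = ∃[ x ] (S x × (∀ i → u i ≡ pow x (q ℕ.^ (s ℕ.* toℕ i))))

  GabFull : (q k s : ℕ) → Vec k → Set
  GabFull q k s = Gab q k s (λ _ → ⊤)

  diagFrob : (q k s : ℕ) → Carrier → Mat k
  diagFrob q k s d i j = idM i j * pow d (q ℕ.^ (s ℕ.* toℕ i))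

  IsScaled : Carrier → (Carrier → Set) → (Carrier → Set) → Set
  IsScaled α S T = ∀ y → T y ⇔ (∃[ x ] (S x × y ≡ α * x))

-- A matrix A carrying G_{k,s,m}[S] onto G_{k,s,m}[T] sends every (σ⁰x, …, σᵏ⁻¹x), x ∈ S,
-- to some (σ⁰y, …, σᵏ⁻¹y), where σ x = x^(q^s); so row i + 1 of A, applied to it, is σ of
-- row i. This is a linearized polynomial Σₜ cₜ σᵗ(x), t ≤ k, vanishing on S. It must be
-- zero as soon as S contains k + 1 elements independent over F_q, by a Moore-determinant
-- style induction that uses that the fixed field of σ is F_q (as gcd(s, m) = 1); and for
-- S = F_{q^m}, k < m, by Dedekind's independence of the distinct automorphisms σ⁰, …, σᵏ.
-- Its vanishing coefficients say that below the diagonal the first column of A is zero,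
-- above it the last column is zero, and A_{i+1,j+1} = σ(A_{i,j}); hence
-- A = diag(d, σd, …, σᵏ⁻¹d), where d ≠ 0 as A is invertible, and then T = d S.

module Submission where

open import Defs
open import Level using (0ℓ)
open import Algebra.Bundles using (CommutativeRing; CommutativeMonoid)
open import Algebra.Morphism.Structures using (module MonoidMorphisms)
import Algebra.Properties.CommutativeMonoid.Sum as CommutativeMonoidSum
import Algebra.Properties.CommutativeSemigroup as CommutativeSemigroupProperties
import Algebra.Properties.Ring as RingProperties
open import Data.Empty using (⊥-elim)
open import Data.Fin as Fin using (Fin; zero; suc; toℕ; fromℕ; inject₁)
open import Data.Fin.Permutation using (Permutation; permutation)
import Data.Fin.Properties as Finₚ
open import Data.Fin.Relation.Unary.Top using (view; ‵fromℕ; ‵inject₁)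
open import Data.Maybe using (nothing)
open import Data.Nat using (ℕ; zero; suc; _<_; _≤_; _^_)
import Data.Nat as Nat
open import Data.Nat.Combinatorics using (_C_; nCk≡n!/k![n-k]!; k![n∸k]!∣n!; nCn≡1; nCk≡nC[n∸k])
open import Data.Nat.Coprimality as Coprimality using (gcd≡1⇒coprime; coprime-divisor)
open import Data.Nat.Divisibility using (_∣_; divides; ∣⇒≤; m∣m*n; ∣1⇒≡1; quotient; m∣n⇒n≡quotient*m; n/m≡quotient)
open import Data.Nat.GCD using (gcd; gcd-GCD; module Bézout; gcd[m,n]∣m; gcd[m,n]∣n; gcd[m,n]≢0)
open import Data.Nat.GeneralisedArithmetic using (iterate)
open import Data.Nat.Primality using (Prime; euclidsLemma; prime⇒nonTrivial)
import Data.Nat.Properties as ℕₚ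
open import Data.Product using (∃-syntax; _×_; _,_; proj₁; proj₂)
open import Data.Sum using (_⊎_; inj₁; inj₂; [_,_]′)
open import Data.Unit using (⊤; tt)
open import Data.Vec.Functional using (_∷_; removeAt)
open import Function using (id; _∘_; _⇔_; _↔_; Inverse; mk↔ₛ′; mk⇔; Equivalence)
open import Relation.Binary.Definitions using (DecidableEquality; tri<; tri≈; tri>)
open import Relation.Binary.PropositionalEquality using (_≡_; refl; sym; trans; cong; cong₂; subst; module ≡-Reasoning)
open import Relation.Nullary using (¬_; Dec; yes; no)
open import Tactic.RingSolver using (solve-∀)
open import Tactic.RingSolver.Core.AlmostCommutativeRing using (AlmostCommutativeRing; fromCommutativeRing)

module RingIdentities {c ℓ} (R : CommutativeRing c ℓ) where
  almostCommutativeRing : AlmostCommutativeRing c ℓ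
  almostCommutativeRing = fromCommutativeRing R (λ _ → nothing)

  open AlmostCommutativeRing almostCommutativeRing

  summation-by-parts-step : ∀ c₀ y₀ d a t →
    c₀ * y₀ + (a + t * (d + y₀)) ≈ (t * d + a) + (c₀ + t) * y₀
  summation-by-parts-step = solve-∀ almostCommutativeRing

  synthetic-division-step : ∀ c₀ d r q ρ →
    c₀ + (d + r) * (d * q + ρ) ≈ d * (ρ + (d + r) * q) + (c₀ + r * ρ)
  synthetic-division-step = solve-∀ almostCommutativeRing

module PrimeBinomial {p : ℕ} (p-prime : Prime p) where
  open Nat using (_!; _∸_; _*_)

  p∤n! : ∀ {n} → n < p → ¬ p ∣ n !
  p∤n! {zero}  _   p∣1 = Nat.nonTrivial⇒≢1 {{prime⇒nonTrivial p-prime}} (∣1⇒≡1 p∣1)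
  p∤n! {suc n} n<p p∣n! with euclidsLemma (suc n) (n !) p-prime p∣n!
  ... | inj₁ p∣1+n = ℕₚ.<⇒≱ n<p (∣⇒≤ p∣1+n)
  ... | inj₂ p∣n!  = p∤n! (ℕₚ.<-trans (ℕₚ.n<1+n n) n<p) p∣n!

  n∣n! : ∀ {n} → 0 < n → n ∣ n !
  n∣n! {suc n} _ = m∣m*n (n !)

  p∣pCk : ∀ {k} → 0 < k → k < p → p ∣ p C k
  p∣pCk {k} 0<k k<p = [ id , ⊥-elim ∘ p∤k![p∸k]! ]′ (euclidsLemma (p C k) _ p-prime p∣pCk*k![p∸k]!)
    where
    instance _ = ℕₚ._!*_!≢0 k (p ∸ k)
    k![p∸k]!∣p! = k![n∸k]!∣n! (ℕₚ.<⇒≤ k<p)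

    p∣pCk*k![p∸k]! : p ∣ (p C k) * (k ! * (p ∸ k) !)
    p∣pCk*k![p∸k]! = subst (λ c → p ∣ c * (k ! * (p ∸ k) !))
      (sym (trans (nCk≡n!/k![n-k]! (ℕₚ.<⇒≤ k<p)) (n/m≡quotient k![p∸k]!∣p!)))
      (subst (p ∣_) (m∣n⇒n≡quotient*m k![p∸k]!∣p!) (n∣n! (ℕₚ.<-trans 0<k k<p)))

    p∤k![p∸k]! : ¬ p ∣ k ! * (p ∸ k) !
    p∤k![p∸k]! p∣k![p∸k]! = [ p∤n! k<p , p∤n! (ℕₚ.∸-monoʳ-< 0<k (ℕₚ.<⇒≤ k<p)) ]′
      (euclidsLemma (k !) ((p ∸ k) !) p-prime p∣k![p∸k]!)

gcd[s*r,m]-between : ∀ {s r m} → gcd s m ≡ 1 → 0 < r → r < m → 0 < gcd (s Nat.* r) m × gcd (s Nat.* r) m < m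
gcd[s*r,m]-between {s} {r} {m} gcd[s,m]≡1 0<r r<m = ℕₚ.n≢0⇒n>0 g≢0 , ℕₚ.≤∧≢⇒< g≤m g≢m
  where
  g = gcd (s Nat.* r) m
  instance
    m≢0 : Nat.NonZero m
    m≢0 = Nat.>-nonZero (ℕₚ.<-trans 0<r r<m)

  g≢0 : ¬ g ≡ 0
  g≢0 = gcd[m,n]≢0 (s Nat.* r) m (inj₂ (Nat.≢-nonZero⁻¹ m))

  g≤m : g ≤ m
  g≤m = ∣⇒≤ (gcd[m,n]∣n (s Nat.* r) m)

  -- m | s r with s coprime to m would force m | r, impossible for 0 < r < m.
  g≢m : ¬ g ≡ m
  g≢m g≡m = ℕₚ.<⇒≱ r<m (∣⇒≤ {{Nat.>-nonZero 0<r}} m∣r)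
    where
    m∣r : m ∣ r
    m∣r = coprime-divisor {m} {s} {r} (Coprimality.sym (gcd≡1⇒coprime gcd[s,m]≡1))
      (subst (_∣ s Nat.* r) g≡m (gcd[m,n]∣m (s Nat.* r) m))

infixl 5 _∷ʳ_

_∷ʳ_ : ∀ {a} {A : Set a} {n} → (Fin n → A) → A → Fin (suc n) → A
_∷ʳ_ {n = zero}  xs x zero    = x
_∷ʳ_ {n = suc n} xs x zero    = xs zero
_∷ʳ_ {n = suc n} xs x (suc i) = ((λ j → xs (suc j)) ∷ʳ x) i

∷ʳ-inject₁ : ∀ {a} {A : Set a} {n} (xs : Fin n → A) x i → (xs ∷ʳ x) (inject₁ i) ≡ xs i
∷ʳ-inject₁ {n = suc n} xs x zero    = refl
∷ʳ-inject₁ {n = suc n} xs x (suc i) = ∷ʳ-inject₁ (λ j → xs (suc j)) x i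

∷ʳ-fromℕ : ∀ {a} {A : Set a} {n} (xs : Fin n → A) x → (xs ∷ʳ x) (fromℕ n) ≡ x
∷ʳ-fromℕ {n = zero}  xs x = refl
∷ʳ-fromℕ {n = suc n} xs x = ∷ʳ-fromℕ (λ j → xs (suc j)) x

module FieldProperties (F : FiniteField) where
  open FiniteField F using (0≢1; inverse; size; enum; enum-injective; enum-surjective)

  commutativeRing : CommutativeRing 0ℓ 0ℓ
  commutativeRing = record { isCommutativeRing = FiniteField.isCommutativeRing F }

  open CommutativeRing commutativeRing public hiding (refl; sym; trans; zero)
  open RingProperties ring public
    using (-0#≈0#; +-cancelˡ; -‿anti-homo-+; +-inverseˡ-unique; x+x≈x⇒x≈0;
           x∙y⁻¹≈ε⇒x≈y; x≈y⇒x∙y⁻¹≈ε; x[y-z]≈xy-xz; [y-z]x≈yx-zx)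
  open RingIdentities commutativeRing public
  module *-CS = CommutativeSemigroupProperties *-commutativeSemigroup
  module +-CS = CommutativeSemigroupProperties +-commutativeSemigroup
  open ≡-Reasoning

  index : Carrier → Fin size
  index x = proj₁ (enum-surjective x)

  enum-index : ∀ x → enum (index x) ≡ x
  enum-index x = proj₂ (enum-surjective x)

  index-enum : ∀ i → index (enum i) ≡ i
  index-enum i = enum-injective _ _ (enum-index (enum i))

  _≟_ : DecidableEquality Carrier
  x ≟ y with index x Fin.≟ index y
  ... | yes eq = yes (trans (sym (enum-index x)) (trans (cong enum eq) (enum-index y)))
  ... | no neq = no (λ x≡y → neq (cong index x≡y))

  1≢0 : ¬ 1# ≡ 0#
  1≢0 eq = 0≢1 (sym eq)

  x-y≡0⇒x≡y : ∀ {x y} → x - y ≡ 0# → x ≡ y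
  x-y≡0⇒x≡y = x∙y⁻¹≈ε⇒x≈y _ _

  inv : ∀ x → ¬ x ≡ 0# → Carrier
  inv x x≢0 = proj₁ (inverse x x≢0)

  x*inv≡1 : ∀ x (x≢0 : ¬ x ≡ 0#) → x * inv x x≢0 ≡ 1#
  x*inv≡1 x x≢0 = proj₂ (inverse x x≢0)

  inv*x≡1 : ∀ x (x≢0 : ¬ x ≡ 0#) → inv x x≢0 * x ≡ 1#
  inv*x≡1 x x≢0 = trans (*-comm _ x) (x*inv≡1 x x≢0)

  x*[inv*y]≡y : ∀ {x} (x≢0 : ¬ x ≡ 0#) y → x * (inv x x≢0 * y) ≡ y
  x*[inv*y]≡y {x} x≢0 y = trans (sym (*-assoc _ _ y)) (trans (cong (_* y) (x*inv≡1 x x≢0)) (*-identityˡ y))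

  inv*[x*y]≡y : ∀ {x} (x≢0 : ¬ x ≡ 0#) y → inv x x≢0 * (x * y) ≡ y
  inv*[x*y]≡y {x} x≢0 y = trans (sym (*-assoc _ _ y)) (trans (cong (_* y) (inv*x≡1 x x≢0)) (*-identityˡ y))

  x≢0⇒x*y≡0⇒y≡0 : ∀ {x y} → ¬ x ≡ 0# → x * y ≡ 0# → y ≡ 0#
  x≢0⇒x*y≡0⇒y≡0 {x} {y} x≢0 xy≡0 = begin
    y                    ≡⟨ inv*[x*y]≡y x≢0 y ⟨
    inv x x≢0 * (x * y)  ≡⟨ cong (inv x x≢0 *_) xy≡0 ⟩
    inv x x≢0 * 0#       ≡⟨ zeroʳ _ ⟩
    0#                   ∎

  x*y≡0⇒x≡0⊎y≡0 : ∀ {x y} → x * y ≡ 0# → x ≡ 0# ⊎ y ≡ 0#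
  x*y≡0⇒x≡0⊎y≡0 {x} xy≡0 with x ≟ 0#
  ... | yes x≡0 = inj₁ x≡0
  ... | no x≢0  = inj₂ (x≢0⇒x*y≡0⇒y≡0 x≢0 xy≡0)

  *-≢0 : ∀ {x y} → ¬ x ≡ 0# → ¬ y ≡ 0# → ¬ x * y ≡ 0#
  *-≢0 x≢0 y≢0 xy≡0 with x*y≡0⇒x≡0⊎y≡0 xy≡0
  ... | inj₁ x≡0 = x≢0 x≡0
  ... | inj₂ y≡0 = y≢0 y≡0

  *-cancelʳ-≢0 : ∀ {x y z} → ¬ z ≡ 0# → x * z ≡ y * z → x ≡ y
  *-cancelʳ-≢0 {x} {y} {z} z≢0 eq = x-y≡0⇒x≡y (x≢0⇒x*y≡0⇒y≡0 z≢0 (begin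
    z * (x - y)    ≡⟨ *-comm z _ ⟩
    (x - y) * z    ≡⟨ [y-z]x≈yx-zx z x y ⟩
    x * z - y * z  ≡⟨ x≈y⇒x∙y⁻¹≈ε eq ⟩
    0#             ∎))

  inv-≢0 : ∀ x (x≢0 : ¬ x ≡ 0#) → ¬ inv x x≢0 ≡ 0#
  inv-≢0 x x≢0 eq = 1≢0 (trans (sym (x*inv≡1 x x≢0)) (trans (cong (x *_) eq) (zeroʳ x)))

  ¬∀⇒∃¬ : {P : Carrier → Set} → (∀ x → Dec (P x)) → ¬ (∀ x → P x) → ∃[ x ] ¬ P x
  ¬∀⇒∃¬ {P} P? ¬∀P = let i , ¬Pᵢ = Finₚ.¬∀⟶∃¬ size (P ∘ enum) (P? ∘ enum) ¬∀Pₑ in enum i , ¬Pᵢ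
    where
    ¬∀Pₑ : ¬ (∀ i → P (enum i))
    ¬∀Pₑ ∀Pₑ = ¬∀P (λ x → subst P (enum-index x) (∀Pₑ (index x)))

  y≡0⇒x+y≡x : ∀ {x y} → y ≡ 0# → x + y ≡ x
  y≡0⇒x+y≡x {x} refl = +-identityʳ x

  y≡0⇒y+x≡x : ∀ {x y} → y ≡ 0# → y + x ≡ x
  y≡0⇒y+x≡x {x} refl = +-identityˡ x

  x≡0⇒x*y≡0 : ∀ {x} y → x ≡ 0# → x * y ≡ 0#
  x≡0⇒x*y≡0 y refl = zeroˡ y

  x-0≡x : ∀ x → x - 0# ≡ x
  x-0≡x x = trans (cong (x +_) -0#≈0#) (+-identityʳ x)

  x-y+y≡x : ∀ x y → (x - y) + y ≡ x
  x-y+y≡x x y = begin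
    (x - y) + y    ≡⟨ +-assoc x (- y) y ⟩
    x + (- y + y)  ≡⟨ cong (x +_) (-‿inverseˡ y) ⟩
    x + 0#         ≡⟨ +-identityʳ x ⟩
    x              ∎

  pow-homo-+ : ∀ x m n → pow F x (m Nat.+ n) ≡ pow F x m * pow F x n
  pow-homo-+ x zero    n = sym (*-identityˡ _)
  pow-homo-+ x (suc m) n = trans (cong (x *_) (pow-homo-+ x m n)) (sym (*-assoc x _ _))

  pow-assoc : ∀ x m n → pow F x (m Nat.* n) ≡ pow F (pow F x m) n
  pow-assoc x m zero    = cong (pow F x) (ℕₚ.*-zeroʳ m)
  pow-assoc x m (suc n) = begin
    pow F x (m Nat.* suc n)          ≡⟨ cong (pow F x) (ℕₚ.*-suc m n) ⟩
    pow F x (m Nat.+ m Nat.* n)      ≡⟨ pow-homo-+ x m (m Nat.* n) ⟩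
    pow F x m * pow F x (m Nat.* n)  ≡⟨ cong (pow F x m *_) (pow-assoc x m n) ⟩
    pow F (pow F x m) (suc n)        ∎

  pow-distrib-* : ∀ x y n → pow F (x * y) n ≡ pow F x n * pow F y n
  pow-distrib-* x y zero    = sym (*-identityˡ 1#)
  pow-distrib-* x y (suc n) = trans (cong ((x * y) *_) (pow-distrib-* x y n)) (*-CS.interchange x y _ _)

  pow-1# : ∀ n → pow F 1# n ≡ 1#
  pow-1# zero    = refl
  pow-1# (suc n) = trans (*-identityˡ _) (pow-1# n)

  pow-identityʳ : ∀ x → pow F x 1 ≡ x
  pow-identityʳ = *-identityʳ

  pow-≢0 : ∀ {x} n → ¬ x ≡ 0# → ¬ pow F x n ≡ 0#
  pow-≢0 zero    x≢0 = 1≢0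
  pow-≢0 (suc n) x≢0 = *-≢0 x≢0 (pow-≢0 n x≢0)

  pow≡0⇒x≡0 : ∀ {x} n → pow F x n ≡ 0# → x ≡ 0#
  pow≡0⇒x≡0 {x} n xⁿ≡0 with x ≟ 0#
  ... | yes x≡0 = x≡0
  ... | no x≢0  = ⊥-elim (pow-≢0 n x≢0 xⁿ≡0)

  PowAdditive : ℕ → Set
  PowAdditive n = ∀ x y → pow F (x + y) n ≡ pow F x n + pow F y n

  PowAdditive-1 : PowAdditive 1
  PowAdditive-1 x y = trans (pow-identityʳ (x + y)) (sym (cong₂ _+_ (pow-identityʳ x) (pow-identityʳ y)))

  PowAdditive-* : ∀ {m n} → PowAdditive m → PowAdditive n → PowAdditive (m Nat.* n)
  PowAdditive-* {m} {n} additive-m additive-n x y = begin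
    pow F (x + y) (m Nat.* n)                  ≡⟨ pow-assoc (x + y) m n ⟩
    pow F (pow F (x + y) m) n                  ≡⟨ cong (λ z → pow F z n) (additive-m x y) ⟩
    pow F (pow F x m + pow F y m) n            ≡⟨ additive-n _ _ ⟩
    pow F (pow F x m) n + pow F (pow F y m) n  ≡⟨ cong₂ _+_ (pow-assoc x m n) (pow-assoc y m n) ⟨
    pow F x (m Nat.* n) + pow F y (m Nat.* n)  ∎

  PowAdditive-^ : ∀ {m} → PowAdditive m → ∀ j → PowAdditive (m ^ j)
  PowAdditive-^ additive zero    = PowAdditive-1
  PowAdditive-^ {m} additive (suc j) = PowAdditive-* {m} {m ^ j} additive (PowAdditive-^ additive j)

  PowAdditive⇒pow-0# : ∀ {n} → PowAdditive n → pow F 0# n ≡ 0#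
  PowAdditive⇒pow-0# {n} additive =
    x+x≈x⇒x≈0 _ (trans (sym (additive 0# 0#)) (cong (λ z → pow F z n) (+-identityʳ 0#)))

  PowAdditive⇒pow-neg : ∀ {n} → PowAdditive n → ∀ x → pow F (- x) n ≡ - pow F x n
  PowAdditive⇒pow-neg {n} additive x = +-inverseˡ-unique _ _ (begin
    pow F (- x) n + pow F x n  ≡⟨ additive (- x) x ⟨
    pow F (- x + x) n          ≡⟨ cong (λ z → pow F z n) (-‿inverseˡ x) ⟩
    pow F 0# n                 ≡⟨ PowAdditive⇒pow-0# {n} additive ⟩
    0#                         ∎)

  pow-^-+ : ∀ q a b y → pow F y (q ^ (a Nat.+ b)) ≡ pow F (pow F y (q ^ a)) (q ^ b)
  pow-^-+ q a b y = trans (cong (pow F y) (ℕₚ.^-distribˡ-+-* q a b)) (pow-assoc y (q ^ a) (q ^ b))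

  module _ (q : ℕ) {y : Carrier} where
    Fixed : ℕ → Set
    Fixed a = pow F y (q ^ a) ≡ y

    fixed-* : ∀ {a} → Fixed a → ∀ n → Fixed (n Nat.* a)
    fixed-* fixed zero    = pow-identityʳ y
    fixed-* {a} fixed (suc n) = begin
      pow F y (q ^ (a Nat.+ n Nat.* a))          ≡⟨ pow-^-+ q a (n Nat.* a) y ⟩
      pow F (pow F y (q ^ a)) (q ^ (n Nat.* a))  ≡⟨ cong (λ z → pow F z (q ^ (n Nat.* a))) fixed ⟩
      pow F y (q ^ (n Nat.* a))                  ≡⟨ fixed-* fixed n ⟩
      y                                          ∎

    fixed-+ : ∀ a {b} → Fixed b → pow F y (q ^ (a Nat.+ b)) ≡ pow F y (q ^ a)
    fixed-+ a {b} fixed = begin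
      pow F y (q ^ (a Nat.+ b))          ≡⟨ cong (λ n → pow F y (q ^ n)) (ℕₚ.+-comm a b) ⟩
      pow F y (q ^ (b Nat.+ a))          ≡⟨ pow-^-+ q b a y ⟩
      pow F (pow F y (q ^ b)) (q ^ a)    ≡⟨ cong (λ z → pow F z (q ^ a)) fixed ⟩
      pow F y (q ^ a)                    ∎

    fixed-gcd : ∀ a b → Fixed a → Fixed b → Fixed (gcd a b)
    fixed-gcd a b fixedₐ fixed_b with Bézout.identity (gcd-GCD a b)
    ... | Bézout.+- i j g+jb≡ia = sym (begin
      y                                          ≡⟨ fixed-* fixedₐ i ⟨
      pow F y (q ^ (i Nat.* a))                  ≡⟨ cong (λ n → pow F y (q ^ n)) g+jb≡ia ⟨
      pow F y (q ^ (gcd a b Nat.+ j Nat.* b))    ≡⟨ fixed-+ (gcd a b) (fixed-* fixed_b j) ⟩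
      pow F y (q ^ gcd a b)                      ∎)
    ... | Bézout.-+ i j g+ia≡jb = sym (begin
      y                                          ≡⟨ fixed-* fixed_b j ⟨
      pow F y (q ^ (j Nat.* b))                  ≡⟨ cong (λ n → pow F y (q ^ n)) g+ia≡jb ⟨
      pow F y (q ^ (gcd a b Nat.+ i Nat.* a))    ≡⟨ fixed-+ (gcd a b) (fixed-* fixedₐ i) ⟩
      pow F y (q ^ gcd a b)                      ∎)

  sumF-cong : ∀ n {f g : Fin n → Carrier} → (∀ i → f i ≡ g i) → sumF F n f ≡ sumF F n g
  sumF-cong zero    f≗g = refl
  sumF-cong (suc n) f≗g = cong₂ _+_ (f≗g zero) (sumF-cong n (λ i → f≗g (suc i)))

  sumF-zero : ∀ n {f : Fin n → Carrier} → (∀ i → f i ≡ 0#) → sumF F n f ≡ 0#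
  sumF-zero zero    f≗0 = refl
  sumF-zero (suc n) f≗0 = trans (cong₂ _+_ (f≗0 zero) (sumF-zero n (λ i → f≗0 (suc i)))) (+-identityˡ 0#)

  sumF-distrib-+ : ∀ n (f g : Fin n → Carrier) → sumF F n (λ i → f i + g i) ≡ sumF F n f + sumF F n g
  sumF-distrib-+ zero    f g = sym (+-identityˡ 0#)
  sumF-distrib-+ (suc n) f g =
    trans (cong ((f zero + g zero) +_) (sumF-distrib-+ n _ _)) (+-CS.interchange _ _ _ _)

  sumF-distrib-neg : ∀ n (f : Fin n → Carrier) → sumF F n (λ i → - f i) ≡ - sumF F n f
  sumF-distrib-neg zero    f = sym -0#≈0#
  sumF-distrib-neg (suc n) f = trans (cong (- f zero +_) (sumF-distrib-neg n _))
    (trans (+-comm _ _) (sym (-‿anti-homo-+ (f zero) (sumF F n (λ i → f (suc i))))))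

  sumF-distrib-sub : ∀ n (f g : Fin n → Carrier) → sumF F n (λ i → f i - g i) ≡ sumF F n f - sumF F n g
  sumF-distrib-sub n f g = trans (sumF-distrib-+ n f (λ i → - g i)) (cong (sumF F n f +_) (sumF-distrib-neg n g))

  *-distribˡ-sumF : ∀ n x (f : Fin n → Carrier) → x * sumF F n f ≡ sumF F n (λ i → x * f i)
  *-distribˡ-sumF zero    x f = zeroʳ x
  *-distribˡ-sumF (suc n) x f = trans (distribˡ x _ _) (cong (x * f zero +_) (*-distribˡ-sumF n x _))

  sumF-init-last : ∀ n (f : Fin (suc n) → Carrier) →
    sumF F (suc n) f ≡ sumF F n (λ i → f (inject₁ i)) + f (fromℕ n)
  sumF-init-last zero    f = trans (+-identityʳ _) (sym (+-identityˡ _))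
  sumF-init-last (suc n) f =
    trans (cong (f zero +_) (sumF-init-last n (λ i → f (suc i)))) (sym (+-assoc _ _ _))

  sumF-∷ʳ-0# : ∀ n (a : Fin n → Carrier) (y : Fin (suc n) → Carrier) →
    sumF F (suc n) (λ t → (a ∷ʳ 0#) t * y t) ≡ sumF F n (λ j → a j * y (inject₁ j))
  sumF-∷ʳ-0# n a y = begin
    sumF F (suc n) (λ t → (a ∷ʳ 0#) t * y t)
      ≡⟨ sumF-init-last n (λ t → (a ∷ʳ 0#) t * y t) ⟩
    sumF F n (λ j → (a ∷ʳ 0#) (inject₁ j) * y (inject₁ j)) + (a ∷ʳ 0#) (fromℕ n) * y (fromℕ n)
      ≡⟨ y≡0⇒x+y≡x (x≡0⇒x*y≡0 (y (fromℕ n)) (∷ʳ-fromℕ a 0#)) ⟩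
    sumF F n (λ j → (a ∷ʳ 0#) (inject₁ j) * y (inject₁ j))
      ≡⟨ sumF-cong n (λ j → cong (_* y (inject₁ j)) (∷ʳ-inject₁ a 0# j)) ⟩
    sumF F n (λ j → a j * y (inject₁ j))
      ∎

  idM-diag : ∀ {k} (i : Fin k) → idM F i i ≡ 1#
  idM-diag i with i Fin.≟ i
  ... | yes _  = refl
  ... | no i≢i = ⊥-elim (i≢i refl)

  idM-offdiag : ∀ {k} (i j : Fin k) → ¬ i ≡ j → idM F i j ≡ 0#
  idM-offdiag i j i≢j with i Fin.≟ j
  ... | yes i≡j = ⊥-elim (i≢j i≡j)
  ... | no _    = refl

  idM-suc : ∀ {k} (i j : Fin k) → idM F (suc i) (suc j) ≡ idM F i j
  idM-suc i j = by-cases (i Fin.≟ j)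
    where
    by-cases : Dec (i ≡ j) → idM F (suc i) (suc j) ≡ idM F i j
    by-cases (yes refl) = trans (idM-diag (suc i)) (sym (idM-diag i))
    by-cases (no i≢j)   = trans (idM-offdiag _ _ (λ eq → i≢j (Finₚ.suc-injective eq))) (sym (idM-offdiag i j i≢j))

  sumF-idM : ∀ n (i : Fin n) (f : Fin n → Carrier) → sumF F n (λ j → idM F i j * f j) ≡ f i
  sumF-idM (suc n) zero f = begin
    idM F {suc n} zero zero * f zero + sumF F n (λ j → idM F zero (suc j) * f (suc j))
      ≡⟨ cong₂ _+_ (trans (cong (_* f zero) (idM-diag {suc n} zero)) (*-identityˡ _))
                   (sumF-zero n (λ j → trans (cong (_* f (suc j)) (idM-offdiag zero (suc j) λ ())) (zeroˡ _))) ⟩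
    f zero + 0#  ≡⟨ +-identityʳ _ ⟩
    f zero       ∎
  sumF-idM (suc n) (suc i) f = begin
    idM F (suc i) zero * f zero + sumF F n (λ j → idM F (suc i) (suc j) * f (suc j))
      ≡⟨ cong₂ _+_ (trans (cong (_* f zero) (idM-offdiag (suc i) zero λ ())) (zeroˡ _))
                   (trans (sumF-cong n (λ j → cong (_* f (suc j)) (idM-suc i j)))
                          (sumF-idM n i (λ j → f (suc j)))) ⟩
    0# + f (suc i)  ≡⟨ +-identityˡ _ ⟩
    f (suc i)       ∎

  module EnumerationSum (M : CommutativeMonoid 0ℓ 0ℓ) where
    open CommutativeMonoid M using () renaming (Carrier to A; _≈_ to _≈ᴹ_; trans to ≈-trans; reflexive to ≈-reflexive)
    open CommutativeMonoidSum M using (sum; sum-permute; sum-cong-≗)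

    sum-enum-bijection : (h : Carrier ↔ Carrier) (g : Carrier → A) →
      sum (λ i → g (enum i)) ≈ᴹ sum (λ i → g (Inverse.to h (enum i)))
    sum-enum-bijection h g =
      ≈-trans (sum-permute _ π) (≈-reflexive (sum-cong-≗ (λ i → cong g (enum-index (to (enum i))))))
      where
      open Inverse h using (to; from; strictlyInverseˡ; strictlyInverseʳ)

      on-indices : ∀ (f f⁻¹ : Carrier → Carrier) → (∀ y → f (f⁻¹ y) ≡ y) →
        ∀ i → index (f (enum (index (f⁻¹ (enum i))))) ≡ i
      on-indices f f⁻¹ f∘f⁻¹≗id i =
        trans (cong (index ∘ f) (enum-index _)) (trans (cong index (f∘f⁻¹≗id _)) (index-enum i))

      π : Permutation size size
      π = permutation (index ∘ to ∘ enum) (index ∘ from ∘ enum)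
            (on-indices to from strictlyInverseˡ) (on-indices from to strictlyInverseʳ)

  sumF≡sum : ∀ n (f : Fin n → Carrier) → sumF F n f ≡ CommutativeMonoidSum.sum +-commutativeMonoid f
  sumF≡sum zero    f = refl
  sumF≡sum (suc n) f = cong (f zero +_) (sumF≡sum n _)

  sumF-enum-bijection : (h : Carrier ↔ Carrier) (g : Carrier → Carrier) →
    sumF F size (λ i → g (enum i)) ≡ sumF F size (λ i → g (Inverse.to h (enum i)))
  sumF-enum-bijection h g = begin
    sumF F size (λ i → g (enum i))                ≡⟨ sumF≡sum size _ ⟩
    _                                             ≡⟨ EnumerationSum.sum-enum-bijection +-commutativeMonoid h g ⟩
    _                                             ≡⟨ sumF≡sum size _ ⟨
    sumF F size (λ i → g (Inverse.to h (enum i))) ∎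

module Fermat (F : FiniteField) where
  open FieldProperties F
  open FiniteField F using (size; enum)
  open ≡-Reasoning
  private module Π = CommutativeMonoidSum *-commutativeMonoid

  product : ∀ {n} → (Fin n → Carrier) → Carrier
  product = Π.sum

  product-≢0 : ∀ {n} (f : Fin n → Carrier) → (∀ i → ¬ f i ≡ 0#) → ¬ product f ≡ 0#
  product-≢0 {zero}  f f≢0 = 1≢0
  product-≢0 {suc n} f f≢0 = *-≢0 (f≢0 zero) (product-≢0 (λ i → f (suc i)) (λ i → f≢0 (suc i)))

  product-scale : ∀ {n} a (f : Fin n → Carrier) → product (λ i → a * f i) ≡ pow F a n * product f
  product-scale {zero}  a f = sym (*-identityˡ 1#)
  product-scale {suc n} a f =
    trans (cong ((a * f zero) *_) (product-scale a (λ i → f (suc i)))) (*-CS.interchange a _ _ _)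

  product-differ-at : ∀ {n} (i₀ : Fin n) a (f g : Fin n → Carrier) →
    (∀ i → ¬ i ≡ i₀ → f i ≡ g i) → f i₀ ≡ a * g i₀ → product f ≡ a * product g
  product-differ-at {suc n} i₀ a f g f≡g f₀≡ag₀ = begin
    product f
      ≡⟨ Π.sum-remove {i = i₀} f ⟩
    f i₀ * product (removeAt f i₀)
      ≡⟨ cong₂ _*_ f₀≡ag₀ (Π.sum-cong-≗ (λ j → f≡g _ (Finₚ.punchInᵢ≢i i₀ j))) ⟩
    (a * g i₀) * product (removeAt g i₀)
      ≡⟨ *-assoc a _ _ ⟩
    a * (g i₀ * product (removeAt g i₀))
      ≡⟨ cong (a *_) (Π.sum-remove {i = i₀} g) ⟨
    a * product g
      ∎

  nonzeroOr1 : Carrier → Carrier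
  nonzeroOr1 x with x ≟ 0#
  ... | yes _ = 1#
  ... | no _  = x

  nonzeroOr1-≢0 : ∀ {x} → ¬ x ≡ 0# → nonzeroOr1 x ≡ x
  nonzeroOr1-≢0 {x} x≢0 with x ≟ 0#
  ... | yes x≡0 = ⊥-elim (x≢0 x≡0)
  ... | no _    = refl

  nonzeroOr1≢0 : ∀ x → ¬ nonzeroOr1 x ≡ 0#
  nonzeroOr1≢0 x with x ≟ 0#
  ... | yes _  = 1≢0
  ... | no x≢0 = x≢0

  -- Multiplication by a permutes the field; comparing the products of all nonzero
  -- elements before and after (with 0 replaced by 1) leaves the factor a^size = a.
  pow-size-≢0 : ∀ {a} → ¬ a ≡ 0# → pow F a size ≡ a
  pow-size-≢0 {a} a≢0 = *-cancelʳ-≢0 (product-≢0 _ (λ i → nonzeroOr1≢0 (enum i))) (begin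
    pow F a size * P
      ≡⟨ product-scale a (λ i → nonzeroOr1 (enum i)) ⟨
    product (λ i → a * nonzeroOr1 (enum i))
      ≡⟨ product-differ-at (index 0#) a _ (λ i → nonzeroOr1 (a * enum i)) differ at-zero ⟩
    a * product (λ i → nonzeroOr1 (a * enum i))
      ≡⟨ cong (a *_) (EnumerationSum.sum-enum-bijection *-commutativeMonoid scaling nonzeroOr1) ⟨
    a * P
      ∎)
    where
    P = product (λ i → nonzeroOr1 (enum i))

    scaling : Carrier ↔ Carrier
    scaling = mk↔ₛ′ (a *_) (inv a a≢0 *_) (x*[inv*y]≡y a≢0) (inv*[x*y]≡y a≢0)

    differ : ∀ i → ¬ i ≡ index 0# → a * nonzeroOr1 (enum i) ≡ nonzeroOr1 (a * enum i)
    differ i i≢i₀ = trans (cong (a *_) (nonzeroOr1-≢0 eᵢ≢0)) (sym (nonzeroOr1-≢0 (*-≢0 a≢0 eᵢ≢0)))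
      where
      eᵢ≢0 : ¬ enum i ≡ 0#
      eᵢ≢0 eᵢ≡0 = i≢i₀ (trans (sym (index-enum i)) (cong index eᵢ≡0))

    at-zero : a * nonzeroOr1 (enum (index 0#)) ≡ a * nonzeroOr1 (a * enum (index 0#))
    at-zero = cong (λ x → a * nonzeroOr1 x)
      (trans (enum-index 0#) (sym (trans (cong (a *_) (enum-index 0#)) (zeroʳ a))))

  pow-size : ∀ a → pow F a size ≡ a
  pow-size a with a ≟ 0#
  ... | no a≢0   = pow-size-≢0 a≢0
  ... | yes refl = pow-0 size (index 0#)
    where
    pow-0 : ∀ n → Fin n → pow F 0# n ≡ 0#
    pow-0 (suc n) _ = zeroˡ _

module Characteristic (F : FiniteField) {p n : ℕ} (p-prime : Prime p) (size≡pⁿ : FiniteField.size F ≡ p ^ n) where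
  open FieldProperties F
  open FiniteField F using (size; enum)
  open import Algebra.Properties.Semiring.Mult semiring using (×-assoc-*; ×1-homo-*) renaming (_×_ to _⨰_)
  open import Algebra.Properties.Semiring.Exp semiring using () renaming (_^_ to _^ᴿ_)
  import Algebra.Properties.Semiring.Binomial semiring as Binomial
  open ≡-Reasoning

  n⨰x≡[n⨰1]*x : ∀ m x → m ⨰ x ≡ (m ⨰ 1#) * x
  n⨰x≡[n⨰1]*x m x = trans (cong (m ⨰_) (sym (*-identityˡ x))) (sym (×-assoc-* m 1# x))

  sumF-const : ∀ m a → sumF F m (λ _ → a) ≡ m ⨰ a
  sumF-const zero    a = refl
  sumF-const (suc m) a = cong (a +_) (sumF-const m a)

  -- Translation by x permutes the field, so it does not change the sum of all elements.
  size⨰x≡0 : ∀ x → size ⨰ x ≡ 0#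
  size⨰x≡0 x = sym (+-cancelˡ total 0# (size ⨰ x) (begin
    total + 0#                      ≡⟨ +-identityʳ total ⟩
    total                           ≡⟨ sumF-enum-bijection translation id ⟩
    sumF F size (λ i → enum i + x)  ≡⟨ sumF-distrib-+ size enum (λ _ → x) ⟩
    total + sumF F size (λ _ → x)   ≡⟨ cong (total +_) (sumF-const size x) ⟩
    total + size ⨰ x                ∎))
    where
    total = sumF F size enum
    translation : Carrier ↔ Carrier
    translation = mk↔ₛ′ (_+ x) (_- x) (λ y → x-y+y≡x y x)
      (λ y → trans (+-assoc y x (- x)) (trans (cong (y +_) (-‿inverseʳ x)) (+-identityʳ y)))

  p⨰1≡0 : p ⨰ 1# ≡ 0#
  p⨰1≡0 = from-power n (trans (cong (_⨰ 1#) (sym size≡pⁿ)) (size⨰x≡0 1#))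
    where
    from-power : ∀ j → (p ^ j) ⨰ 1# ≡ 0# → p ⨰ 1# ≡ 0#
    from-power zero    1+0≡0 = ⊥-elim (1≢0 (trans (sym (+-identityʳ 1#)) 1+0≡0))
    from-power (suc j) pʲ⁺¹≡0 with x*y≡0⇒x≡0⊎y≡0 (trans (sym (×1-homo-* p (p ^ j))) pʲ⁺¹≡0)
    ... | inj₁ p≡0  = p≡0
    ... | inj₂ pʲ≡0 = from-power j pʲ≡0

  pCk⨰x≡0 : ∀ {k} → 0 < k → k < p → ∀ x → (p C k) ⨰ x ≡ 0#
  pCk⨰x≡0 {k} 0<k k<p x with PrimeBinomial.p∣pCk p-prime 0<k k<p
  ... | divides c pCk≡c*p = begin
    (p C k) ⨰ x                  ≡⟨ n⨰x≡[n⨰1]*x (p C k) x ⟩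
    ((p C k) ⨰ 1#) * x           ≡⟨ cong (λ m → (m ⨰ 1#) * x) pCk≡c*p ⟩
    ((c Nat.* p) ⨰ 1#) * x       ≡⟨ cong (_* x) (×1-homo-* c p) ⟩
    ((c ⨰ 1#) * (p ⨰ 1#)) * x    ≡⟨ cong (λ z → ((c ⨰ 1#) * z) * x) p⨰1≡0 ⟩
    ((c ⨰ 1#) * 0#) * x          ≡⟨ x≡0⇒x*y≡0 x (zeroʳ _) ⟩
    0#                           ∎

  pow≡^ᴿ : ∀ x m → pow F x m ≡ x ^ᴿ m
  pow≡^ᴿ x zero    = refl
  pow≡^ᴿ x (suc m) = cong (x *_) (pow≡^ᴿ x m)

  middle-binomials-vanish⇒PowAdditive : ∀ {P} → 1 < P → (∀ {k} → 0 < k → k < P → ∀ z → (P C k) ⨰ z ≡ 0#) →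
    PowAdditive P
  middle-binomials-vanish⇒PowAdditive {suc zero} (Nat.s≤s ())
  middle-binomials-vanish⇒PowAdditive {suc (suc r)} _ middle≡0 x y = begin
    pow F (x + y) P                         ≡⟨ pow≡^ᴿ (x + y) P ⟩
    (x + y) ^ᴿ P                            ≡⟨ B.theorem (*-comm x y) P ⟩
    B.binomialExpansion P                   ≡⟨ sumF≡sum (suc P) (B.binomialTerm P) ⟨
    sumF F (suc P) (B.binomialTerm P)       ≡⟨ cong (first +_) (sumF-init-last (suc r) (λ i → B.binomialTerm P (suc i))) ⟩
    first + (sumF F (suc r) middle + last)  ≡⟨ cong (first +_) (y≡0⇒y+x≡x (sumF-zero (suc r) middle-vanishes)) ⟩
    first + last                            ≡⟨ cong₂ _+_ first≡yᴾ last≡xᴾ ⟩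
    pow F y P + pow F x P                   ≡⟨ +-comm _ _ ⟩
    pow F x P + pow F y P                   ∎
    where
    P = suc (suc r)
    module B = Binomial x y
    first = B.binomialTerm P zero
    last  = B.binomialTerm P (suc (fromℕ (suc r)))
    middle = λ i → B.binomialTerm P (suc (inject₁ i))

    middle-vanishes : ∀ i → middle i ≡ 0#
    middle-vanishes i = middle≡0 (Nat.s≤s Nat.z≤n)
      (Nat.s≤s (subst (Nat._< suc r) (sym (Finₚ.toℕ-inject₁ i)) (Finₚ.toℕ<n i))) _

    first≡yᴾ : first ≡ pow F y P
    first≡yᴾ = begin
      (P C 0) ⨰ (1# * y ^ᴿ P)  ≡⟨ cong (_⨰ (1# * y ^ᴿ P)) (trans (nCk≡nC[n∸k] {k = 0} {n = P} Nat.z≤n) (nCn≡1 P)) ⟩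
      1# * y ^ᴿ P + 0#         ≡⟨ trans (+-identityʳ _) (*-identityˡ _) ⟩
      y ^ᴿ P                   ≡⟨ pow≡^ᴿ y P ⟨
      pow F y P                ∎

    last≡xᴾ : last ≡ pow F x P
    last≡xᴾ = begin
      (P C toℕ (fromℕ P)) ⨰ (x ^ᴿ toℕ (fromℕ P) * y ^ᴿ (P Nat.∸ toℕ (fromℕ P)))
        ≡⟨ cong (λ k → (P C k) ⨰ (x ^ᴿ k * y ^ᴿ (P Nat.∸ k))) (Finₚ.toℕ-fromℕ P) ⟩
      (P C P) ⨰ (x ^ᴿ P * y ^ᴿ (P Nat.∸ P))
        ≡⟨ cong₂ (λ c d → c ⨰ (x ^ᴿ P * y ^ᴿ d)) (nCn≡1 P) (ℕₚ.n∸n≡0 P) ⟩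
      x ^ᴿ P * 1# + 0#         ≡⟨ trans (+-identityʳ _) (*-identityʳ _) ⟩
      x ^ᴿ P                   ≡⟨ pow≡^ᴿ x P ⟨
      pow F x P                ∎

  pow-p-additive : PowAdditive p
  pow-p-additive = middle-binomials-vanish⇒PowAdditive (Nat.nonTrivial⇒n>1 p {{prime⇒nonTrivial p-prime}}) pCk⨰x≡0

module PolynomialRoots (F : FiniteField) where
  open FieldProperties F
  open FiniteField F using (size; enum; enum-injective)
  open ≡-Reasoning

  horner : ∀ n → (Fin n → Carrier) → Carrier → Carrier
  horner zero    c x = 0#
  horner (suc n) c x = c zero + x * horner n (λ i → c (suc i)) x

  horner≡sumF : ∀ n (c : Fin n → Carrier) x → horner n c x ≡ sumF F n (λ t → c t * pow F x (toℕ t))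
  horner≡sumF zero    c x = refl
  horner≡sumF (suc n) c x = cong₂ _+_ (sym (*-identityʳ _)) (begin
    x * horner n (λ i → c (suc i)) x                      ≡⟨ cong (x *_) (horner≡sumF n _ x) ⟩
    x * sumF F n (λ t → c (suc t) * pow F x (toℕ t))      ≡⟨ *-distribˡ-sumF n x _ ⟩
    sumF F n (λ t → x * (c (suc t) * pow F x (toℕ t)))    ≡⟨ sumF-cong n (λ t → *-CS.x∙yz≈y∙xz x _ _) ⟩
    sumF F n (λ t → c (suc t) * (x * pow F x (toℕ t)))    ∎)

  -- Synthetic division: the coefficients of the quotient of c(X) by X - r.
  divide : ∀ {n} → Carrier → (Fin (suc n) → Carrier) → Fin n → Carrier
  divide {suc n} r c zero    = horner (suc n) (λ i → c (suc i)) r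
  divide {suc n} r c (suc i) = divide r (λ j → c (suc j)) i

  horner-divide : ∀ n r (c : Fin (suc n) → Carrier) x →
    horner (suc n) c x ≡ (x - r) * horner n (divide r c) x + horner (suc n) c r
  horner-divide zero r c x =
    trans (y≡0⇒x+y≡x (zeroʳ x)) (sym (trans (y≡0⇒y+x≡x (zeroʳ (x - r))) (y≡0⇒x+y≡x (zeroʳ r))))
  horner-divide (suc n) r c x = begin
    c zero + x * horner (suc n) c′ x            ≡⟨ cong (λ z → c zero + x * z) (horner-divide n r c′ x) ⟩
    c zero + x * (d * q + ρ)                   ≡⟨ cong (λ z → c zero + z * (d * q + ρ)) (x-y+y≡x x r) ⟨
    c zero + (d + r) * (d * q + ρ)             ≡⟨ synthetic-division-step (c zero) d r q ρ ⟩
    d * (ρ + (d + r) * q) + (c zero + r * ρ)   ≡⟨ cong (λ z → d * (ρ + z * q) + (c zero + r * ρ)) (x-y+y≡x x r) ⟩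
    d * (ρ + x * q) + (c zero + r * ρ)         ∎
    where
    c′ = λ i → c (suc i)
    d  = x - r
    q  = horner n (divide r c′) x
    ρ  = horner (suc n) c′ r

  divide≡0⇒≡0 : ∀ n r (c : Fin (suc n) → Carrier) →
    (∀ i → divide r c i ≡ 0#) → horner (suc n) c r ≡ 0# → ∀ t → c t ≡ 0#
  divide≡0⇒≡0 zero    r c _ c[r]≡0 zero = trans (sym (y≡0⇒x+y≡x (zeroʳ r))) c[r]≡0
  divide≡0⇒≡0 (suc n) r c quotient≡0 c[r]≡0 zero =
    trans (sym (y≡0⇒x+y≡x (trans (cong (r *_) (quotient≡0 zero)) (zeroʳ r)))) c[r]≡0
  divide≡0⇒≡0 (suc n) r c quotient≡0 c[r]≡0 (suc t) =
    divide≡0⇒≡0 n r (λ i → c (suc i)) (λ i → quotient≡0 (suc i)) (quotient≡0 zero) t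

  roots-bound : ∀ n (c r : Fin n → Carrier) → (∀ i j → r i ≡ r j → i ≡ j) →
    (∀ i → horner n c (r i) ≡ 0#) → ∀ t → c t ≡ 0#
  roots-bound (suc n) c r r-injective roots =
    divide≡0⇒≡0 n r₀ c (roots-bound n (divide r₀ c) (λ i → r (suc i)) r′-injective quotient-roots) c[r₀]≡0
    where
    r₀ = r zero

    r′-injective : ∀ i j → r (suc i) ≡ r (suc j) → i ≡ j
    r′-injective i j eq = Finₚ.suc-injective (r-injective _ _ eq)

    c[r₀]≡0 : horner (suc n) c r₀ ≡ 0#
    c[r₀]≡0 = roots zero

    quotient-roots : ∀ i → horner n (divide r₀ c) (r (suc i)) ≡ 0#
    quotient-roots i = x≢0⇒x*y≡0⇒y≡0 rᵢ-r₀≢0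
      (trans (sym (y≡0⇒x+y≡x c[r₀]≡0)) (trans (sym (horner-divide n r₀ c (r (suc i)))) (roots (suc i))))
      where
      rᵢ-r₀≢0 : ¬ r (suc i) - r₀ ≡ 0#
      rᵢ-r₀≢0 eq = Finₚ.0≢1+n (sym (r-injective _ _ (x-y≡0⇒x≡y eq)))

  sumF-idM-difference : ∀ n (a b : Fin n) (f : Fin n → Carrier) →
    sumF F n (λ t → (idM F a t - idM F b t) * f t) ≡ f a - f b
  sumF-idM-difference n a b f = begin
    sumF F n (λ t → (idM F a t - idM F b t) * f t)
      ≡⟨ sumF-cong n (λ t → [y-z]x≈yx-zx (f t) (idM F a t) (idM F b t)) ⟩
    sumF F n (λ t → idM F a t * f t - idM F b t * f t)
      ≡⟨ sumF-distrib-sub n _ _ ⟩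
    sumF F n (λ t → idM F a t * f t) - sumF F n (λ t → idM F b t * f t)
      ≡⟨ cong₂ _-_ (sumF-idM n a f) (sumF-idM n b f) ⟩
    f a - f b
      ∎

  -- y ↦ y^N - y would be a nonzero polynomial of degree N with size > N roots.
  pow-not-identity : ∀ {N} → 2 ≤ N → N < size → ¬ (∀ y → pow F y N ≡ y)
  pow-not-identity {suc zero} (Nat.s≤s ())
  pow-not-identity {suc (suc M)} _ N<size pow-id =
    1≢0 (trans (sym c-top) (roots-bound (suc N) c r r-injective roots top))
    where
    N = suc (suc M)
    top one : Fin (suc N)
    top = fromℕ N
    one = suc zero

    one≢top : ¬ one ≡ top
    one≢top eq = ℕₚ.<-irrefl (trans (cong toℕ eq) (Finₚ.toℕ-fromℕ N)) (Nat.s≤s (Nat.s≤s Nat.z≤n))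

    c : Fin (suc N) → Carrier
    c t = idM F top t - idM F one t

    c-top : c top ≡ 1#
    c-top = trans (cong₂ _-_ (idM-diag top) (idM-offdiag one top one≢top)) (x-0≡x 1#)

    r : Fin (suc N) → Carrier
    r i = enum (Fin.inject≤ i N<size)

    r-injective : ∀ i j → r i ≡ r j → i ≡ j
    r-injective i j eq = Finₚ.inject≤-injective N<size N<size i j (enum-injective _ _ eq)

    roots : ∀ i → horner (suc N) c (r i) ≡ 0#
    roots i = begin
      horner (suc N) c y
        ≡⟨ horner≡sumF (suc N) c y ⟩
      sumF F (suc N) (λ t → c t * pow F y (toℕ t))
        ≡⟨ sumF-idM-difference (suc N) top one (λ t → pow F y (toℕ t)) ⟩
      pow F y (toℕ top) - pow F y 1
        ≡⟨ cong₂ _-_ (trans (cong (pow F y) (Finₚ.toℕ-fromℕ N)) (pow-id y)) (pow-identityʳ y) ⟩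
      y - y
        ≡⟨ -‿inverseʳ y ⟩
      0#
        ∎
      where y = r i

module CharacterIndependence (F : FiniteField) where
  open FieldProperties F
  open MonoidMorphisms *-rawMonoid *-rawMonoid using (IsMonoidHomomorphism)
  open IsMonoidHomomorphism using (homo; ε-homo)
  open ≡-Reasoning

  characters-independent : ∀ n (χ : Fin n → Carrier → Carrier) → (∀ t → IsMonoidHomomorphism (χ t)) →
    (∀ a b → ¬ a ≡ b → ∃[ y ] ¬ χ a y ≡ χ b y) →
    ∀ (c : Fin n → Carrier) → (∀ x → sumF F n (λ t → c t * χ t x) ≡ 0#) → ∀ t → c t ≡ 0#
  characters-independent (suc n) χ χ-hom χ-distinct c vanishes = coefficient
    where
    tail≡0 : ∀ t → c (suc t) ≡ 0#
    tail≡0 t with χ-distinct (suc t) zero (λ ())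
    ... | y , χₜy≢χ₀y = x≢0⇒x*y≡0⇒y≡0 χₜy-χ₀y≢0 (trans (*-comm _ (c (suc t))) c′ₜ≡0)
      where
      d = χ zero y
      χₜy-χ₀y≢0 : ¬ χ (suc t) y - d ≡ 0#
      χₜy-χ₀y≢0 eq = χₜy≢χ₀y (x-y≡0⇒x≡y eq)

      c′ : Fin (suc n) → Carrier
      c′ s = c s * (χ s y - d)

      c′₀≡0 : c′ zero ≡ 0#
      c′₀≡0 = trans (cong (c zero *_) (-‿inverseʳ d)) (zeroʳ (c zero))

      -- The relation at y * x minus d times the relation at x has no χ₀-term.
      c′-vanishes : ∀ x → sumF F (suc n) (λ s → c′ s * χ s x) ≡ 0#
      c′-vanishes x = begin
        sumF F (suc n) (λ s → c′ s * χ s x)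
          ≡⟨ sumF-cong (suc n) term ⟩
        sumF F (suc n) (λ s → c s * χ s (y * x) - d * (c s * χ s x))
          ≡⟨ sumF-distrib-sub (suc n) (λ s → c s * χ s (y * x)) (λ s → d * (c s * χ s x)) ⟩
        sumF F (suc n) (λ s → c s * χ s (y * x)) - sumF F (suc n) (λ s → d * (c s * χ s x))
          ≡⟨ cong₂ _-_ (vanishes (y * x)) (sym (*-distribˡ-sumF (suc n) d (λ s → c s * χ s x))) ⟩
        0# - d * sumF F (suc n) (λ s → c s * χ s x)
          ≡⟨ cong (λ z → 0# - d * z) (vanishes x) ⟩
        0# - d * 0#
          ≡⟨ trans (cong (λ z → 0# - z) (zeroʳ d)) (-‿inverseʳ 0#) ⟩
        0# ∎
        where
        term : ∀ s → c′ s * χ s x ≡ c s * χ s (y * x) - d * (c s * χ s x)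
        term s = begin
          (c s * (χ s y - d)) * χ s x              ≡⟨ cong (_* χ s x) (x[y-z]≈xy-xz (c s) (χ s y) d) ⟩
          (c s * χ s y - c s * d) * χ s x          ≡⟨ [y-z]x≈yx-zx (χ s x) (c s * χ s y) (c s * d) ⟩
          (c s * χ s y) * χ s x - (c s * d) * χ s x
            ≡⟨ cong₂ _-_ (trans (*-assoc _ _ _) (cong (c s *_) (sym (homo (χ-hom s) y x))))
                         (*-CS.xy∙z≈y∙xz (c s) d (χ s x)) ⟩
          c s * χ s (y * x) - d * (c s * χ s x)    ∎

      c′ₜ≡0 : c′ (suc t) ≡ 0#
      c′ₜ≡0 = characters-independent n (λ s → χ (suc s)) (λ s → χ-hom (suc s))
        (λ a b a≢b → χ-distinct (suc a) (suc b) (λ eq → a≢b (Finₚ.suc-injective eq)))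
        (λ s → c′ (suc s))
        (λ x → trans (sym (y≡0⇒y+x≡x (x≡0⇒x*y≡0 (χ zero x) c′₀≡0))) (c′-vanishes x))
        t

    coefficient : ∀ t → c t ≡ 0#
    coefficient (suc t) = tail≡0 t
    coefficient zero    = begin
      c zero                                ≡⟨ *-identityʳ _ ⟨
      c zero * 1#                           ≡⟨ cong (c zero *_) (ε-homo (χ-hom zero)) ⟨
      c zero * χ zero 1#
        ≡⟨ y≡0⇒x+y≡x (sumF-zero n (λ t → x≡0⇒x*y≡0 (χ (suc t) 1#) (tail≡0 t))) ⟨
      sumF F (suc n) (λ t → c t * χ t 1#)   ≡⟨ vanishes 1# ⟩
      0#                                    ∎

module Frobenius (F : FiniteField) {p e m : ℕ} (p-prime : Prime p) (1≤e : 1 ≤ e)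
                 (size≡qᵐ : FiniteField.size F ≡ (p ^ e) ^ m) (s : ℕ) (gcd[s,m]≡1 : gcd s m ≡ 1) where
  open FieldProperties F
  open FiniteField F using (size; enum)
  open ≡-Reasoning

  q : ℕ
  q = p ^ e

  1<q : 1 < q
  1<q = ℕₚ.<-≤-trans 1<p (subst (_≤ q) (ℕₚ.*-identityʳ p) (ℕₚ.^-monoʳ-≤ p {{p≢0}} 1≤e))
    where
    1<p : 1 < p
    1<p = Nat.nonTrivial⇒n>1 p {{prime⇒nonTrivial p-prime}}

    p≢0 : Nat.NonZero p
    p≢0 = Nat.>-nonZero (ℕₚ.<-trans Nat.z<s 1<p)

  pow-q^-additive : ∀ j → PowAdditive (q ^ j)
  pow-q^-additive = PowAdditive-^ (PowAdditive-^ pow-p-additive e)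
    where open Characteristic F {n = e Nat.* m} p-prime (trans size≡qᵐ (ℕₚ.^-*-assoc p e m))

  pow-q-additive : PowAdditive q
  pow-q-additive = subst PowAdditive (ℕₚ.*-identityʳ q) (pow-q^-additive 1)

  pow-qᵐ : ∀ y → pow F y (q ^ m) ≡ y
  pow-qᵐ y = subst (λ n → pow F y n ≡ y) size≡qᵐ (Fermat.pow-size F y)

  σ : Carrier → Carrier
  σ x = pow F x (q ^ s)

  σ^ : ℕ → Carrier → Carrier
  σ^ t x = pow F x (q ^ (s Nat.* t))

  σ-homo-+ : ∀ x y → σ (x + y) ≡ σ x + σ y
  σ-homo-+ = pow-q^-additive s

  σ-0# : σ 0# ≡ 0#
  σ-0# = PowAdditive⇒pow-0# {q ^ s} σ-homo-+

  σ≡0⇒x≡0 : ∀ {x} → σ x ≡ 0# → x ≡ 0#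
  σ≡0⇒x≡0 = pow≡0⇒x≡0 (q ^ s)

  σ-homo-sumF : ∀ n (f : Fin n → Carrier) → σ (sumF F n f) ≡ sumF F n (λ i → σ (f i))
  σ-homo-sumF zero    f = σ-0#
  σ-homo-sumF (suc n) f = trans (σ-homo-+ _ _) (cong (σ (f zero) +_) (σ-homo-sumF n (λ i → f (suc i))))

  σ^-homo-+ : ∀ t x y → σ^ t (x + y) ≡ σ^ t x + σ^ t y
  σ^-homo-+ t = pow-q^-additive (s Nat.* t)

  σ^-homo-* : ∀ t x y → σ^ t (x * y) ≡ σ^ t x * σ^ t y
  σ^-homo-* t x y = pow-distrib-* x y (q ^ (s Nat.* t))

  σ^-1# : ∀ t → σ^ t 1# ≡ 1#
  σ^-1# t = pow-1# (q ^ (s Nat.* t))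

  σ^-neg : ∀ t x → σ^ t (- x) ≡ - σ^ t x
  σ^-neg t = PowAdditive⇒pow-neg {q ^ (s Nat.* t)} (σ^-homo-+ t)

  σ^-sub : ∀ t x y → σ^ t (x - y) ≡ σ^ t x - σ^ t y
  σ^-sub t x y = trans (σ^-homo-+ t x (- y)) (cong (σ^ t x +_) (σ^-neg t y))

  σ^≡0⇒x≡0 : ∀ t {x} → σ^ t x ≡ 0# → x ≡ 0#
  σ^≡0⇒x≡0 t = pow≡0⇒x≡0 (q ^ (s Nat.* t))

  σ^-zero : ∀ x → σ^ 0 x ≡ x
  σ^-zero x = trans (cong (λ n → pow F x (q ^ n)) (ℕₚ.*-zeroʳ s)) (pow-identityʳ x)

  σ^-+ : ∀ t u x → σ^ (t Nat.+ u) x ≡ σ^ u (σ^ t x)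
  σ^-+ t u x =
    trans (cong (λ n → pow F x (q ^ n)) (ℕₚ.*-distribˡ-+ s t u)) (pow-^-+ q (s Nat.* t) (s Nat.* u) x)

  σ^-suc : ∀ t x → σ^ (suc t) x ≡ σ (σ^ t x)
  σ^-suc t x = begin
    σ^ (suc t) x         ≡⟨ cong (λ u → σ^ u x) (ℕₚ.+-comm 1 t) ⟩
    σ^ (t Nat.+ 1) x     ≡⟨ σ^-+ t 1 x ⟩
    σ^ 1 (σ^ t x)        ≡⟨ cong (λ n → pow F (σ^ t x) (q ^ n)) (ℕₚ.*-identityʳ s) ⟩
    σ (σ^ t x)           ∎

  σ^-suc′ : ∀ t x → σ^ (suc t) x ≡ σ^ t (σ x)
  σ^-suc′ t x = trans (σ^-+ 1 t x) (cong (λ n → σ^ t (pow F x (q ^ n))) (ℕₚ.*-identityʳ s))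

  InFq⇒fixed : ∀ {c} → InFq F q c → ∀ n → pow F c (q ^ n) ≡ c
  InFq⇒fixed {c} c∈Fq n = subst (λ k → pow F c (q ^ k) ≡ c) (ℕₚ.*-identityʳ n)
    (fixed-* q (trans (cong (pow F c) (ℕₚ.*-identityʳ q)) c∈Fq) n)

  σ-fixed⇒InFq : ∀ {y} → σ y ≡ y → InFq F q y
  σ-fixed⇒InFq {y} σy≡y = trans (cong (pow F y) (sym (ℕₚ.*-identityʳ q)))
    (subst (λ g → pow F y (q ^ g) ≡ y) gcd[s,m]≡1 (fixed-gcd q s m σy≡y (pow-qᵐ y)))

  InFq-0# : InFq F q 0#
  InFq-0# = PowAdditive⇒pow-0# {q} pow-q-additive

  InFq-1# : InFq F q 1#
  InFq-1# = pow-1# q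

  InFq-neg : ∀ {y} → InFq F q y → InFq F q (- y)
  InFq-neg {y} y∈Fq = trans (PowAdditive⇒pow-neg {q} pow-q-additive y) (cong -_ y∈Fq)

  InFq-idM : ∀ {k} (i j : Fin k) → InFq F q (idM F i j)
  InFq-idM i j with i Fin.≟ j
  ... | yes _ = InFq-1#
  ... | no _  = InFq-0#

  σ-Fq-linear : ∀ n (b y : Fin n → Carrier) → (∀ i → InFq F q (b i)) →
    σ (sumF F n (λ i → b i * y i)) ≡ sumF F n (λ i → b i * σ (y i))
  σ-Fq-linear n b y b∈Fq = trans (σ-homo-sumF n _) (sumF-cong n (λ i →
    trans (pow-distrib-* (b i) (y i) (q ^ s)) (cong (_* σ (y i)) (InFq⇒fixed (b∈Fq i) s))))

  -- If σ^a = σ^b then σ^(b-a) fixes every y, so every y is fixed by x ↦ x^(q^g) for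
  -- g = gcd(s(b-a), m) < m: a polynomial identity of degree q^g < q^m, impossible.
  σ^-not-equal : ∀ {a b} → a < b → b < m → ¬ (∀ y → σ^ a y ≡ σ^ b y)
  σ^-not-equal {a} {b} a<b b<m σᵃ≡σᵇ =
    PolynomialRoots.pow-not-identity F 2≤qᵍ qᵍ<size (λ y → fixed-gcd q (s Nat.* r) m (σʳ-fixes y) (pow-qᵐ y))
    where
    r = b Nat.∸ a
    0<g×g<m = gcd[s*r,m]-between {s} {r} {m} gcd[s,m]≡1
      (ℕₚ.m<n⇒0<n∸m a<b) (ℕₚ.≤-<-trans (ℕₚ.m∸n≤m b a) b<m)
    g = gcd (s Nat.* r) m

    σʳ-fixes : ∀ y → σ^ r y ≡ y
    σʳ-fixes y = sym (x-y≡0⇒x≡y (σ^≡0⇒x≡0 a (begin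
      σ^ a (y - σ^ r y)             ≡⟨ σ^-sub a y (σ^ r y) ⟩
      σ^ a y - σ^ a (σ^ r y)        ≡⟨ cong (λ z → σ^ a y - z) (σ^-+ r a y) ⟨
      σ^ a y - σ^ (r Nat.+ a) y     ≡⟨ cong (λ n → σ^ a y - σ^ n y) (ℕₚ.m∸n+n≡m (ℕₚ.<⇒≤ a<b)) ⟩
      σ^ a y - σ^ b y               ≡⟨ x≈y⇒x∙y⁻¹≈ε (σᵃ≡σᵇ y) ⟩
      0#                            ∎)))

    2≤qᵍ : 2 ≤ q ^ g
    2≤qᵍ = ℕₚ.≤-trans 1<q (subst (_≤ q ^ g) (ℕₚ.*-identityʳ q)
      (ℕₚ.^-monoʳ-≤ q {{Nat.>-nonZero (ℕₚ.<-trans Nat.z<s 1<q)}} (proj₁ 0<g×g<m)))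

    qᵍ<size : q ^ g < size
    qᵍ<size = subst (q ^ g <_) (sym size≡qᵐ) (ℕₚ.^-monoʳ-< q 1<q (proj₂ 0<g×g<m))

  σ^-distinct : ∀ {a b} → a < b → b < m → ∃[ y ] ¬ σ^ a y ≡ σ^ b y
  σ^-distinct a<b b<m = ¬∀⇒∃¬ (λ y → σ^ _ y ≟ σ^ _ y) (σ^-not-equal a<b b<m)

module LinearizedPolynomials (F : FiniteField) {p e m : ℕ} (p-prime : Prime p) (1≤e : 1 ≤ e)
                             (size≡qᵐ : FiniteField.size F ≡ (p ^ e) ^ m) (s : ℕ) (gcd[s,m]≡1 : gcd s m ≡ 1) where
  open FieldProperties F
  open Frobenius F p-prime 1≤e size≡qᵐ s gcd[s,m]≡1
  open CharacterIndependence F using (characters-independent)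
  open MonoidMorphisms *-rawMonoid *-rawMonoid using (IsMonoidHomomorphism)
  open ≡-Reasoning

  linearized : ∀ n → (Fin n → Carrier) → Carrier → Carrier
  linearized n c x = sumF F n (λ t → c t * σ^ (toℕ t) x)

  σ-IndependentOn : (Carrier → Set) → ℕ → Set
  σ-IndependentOn S n = ∀ c → (∀ x → S x → linearized n c x ≡ 0#) → ∀ t → c t ≡ 0#

  FqIndependent : ∀ n → (Fin n → Carrier) → Set
  FqIndependent n v = ∀ (c : Fin n → Carrier) → (∀ i → InFq F q (c i)) →
    sumF F n (λ i → c i * v i) ≡ 0# → ∀ i → c i ≡ 0#

  FqIndependent-tail : ∀ {n} {v : Fin (suc n) → Carrier} → FqIndependent (suc n) v →
    FqIndependent n (λ i → v (suc i))
  FqIndependent-tail {v = v} independent c c∈Fq Σ≡0 i = independent (0# ∷ c) 0∷c∈Fq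
    (trans (y≡0⇒y+x≡x (zeroˡ (v zero))) Σ≡0) (suc i)
    where
    0∷c∈Fq : ∀ j → InFq F q ((0# ∷ c) j)
    0∷c∈Fq zero    = InFq-0#
    0∷c∈Fq (suc j) = c∈Fq j

  FqIndependent-raise : ∀ d {n} {v : Fin (d Nat.+ n) → Carrier} → FqIndependent (d Nat.+ n) v →
    FqIndependent n (λ i → v (d Fin.↑ʳ i))
  FqIndependent-raise zero    independent = independent
  FqIndependent-raise (suc d) {v = v} independent =
    FqIndependent-raise d {v = λ i → v (suc i)} (FqIndependent-tail {v = v} independent)

  FqIndependent-≢0 : ∀ {n} {v : Fin n → Carrier} → FqIndependent n v → ∀ i → ¬ v i ≡ 0#
  FqIndependent-≢0 {n} {v} independent i vᵢ≡0 = 1≢0 (trans (sym (idM-diag i))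
    (independent (idM F i) (InFq-idM i) (trans (sumF-idM n i v) vᵢ≡0) i))

  FqIndependent-scale : ∀ {n} {v : Fin n → Carrier} {a} → ¬ a ≡ 0# → FqIndependent n v →
    FqIndependent n (λ j → v j * a)
  FqIndependent-scale {n} {v} {a} a≢0 independent b b∈Fq Σ≡0 = independent b b∈Fq
    (*-cancelʳ-≢0 a≢0 (begin
      sumF F n (λ j → b j * v j) * a      ≡⟨ *-comm _ a ⟩
      a * sumF F n (λ j → b j * v j)      ≡⟨ *-distribˡ-sumF n a _ ⟩
      sumF F n (λ j → a * (b j * v j))    ≡⟨ sumF-cong n (λ j → *-CS.x∙yz≈y∙zx a (b j) (v j)) ⟩
      sumF F n (λ j → b j * (v j * a))    ≡⟨ Σ≡0 ⟩
      0#                                  ≡⟨ zeroˡ a ⟨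
      0# * a                              ∎))

  FqIndependent-σ-differences : ∀ {n} {w : Fin (suc n) → Carrier} → w zero ≡ 1# → FqIndependent (suc n) w →
    FqIndependent n (λ j → σ (w (suc j)) - w (suc j))
  FqIndependent-σ-differences {n} {w} w₀≡1 independent b b∈Fq Σ≡0 i =
    independent ((- Y) ∷ b) -Y∷b∈Fq -Y+Y≡0 (suc i)
    where
    Y = sumF F n (λ j → b j * w (suc j))

    σY≡Y : σ Y ≡ Y
    σY≡Y = x-y≡0⇒x≡y (begin
      σ Y - Y                                                 ≡⟨ cong (_- Y) (σ-Fq-linear n b (λ j → w (suc j)) b∈Fq) ⟩
      sumF F n (λ j → b j * σ (w (suc j))) - Y                ≡⟨ sumF-distrib-sub n _ _ ⟨
      sumF F n (λ j → b j * σ (w (suc j)) - b j * w (suc j))  ≡⟨ sumF-cong n (λ j → x[y-z]≈xy-xz (b j) _ _) ⟨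
      sumF F n (λ j → b j * (σ (w (suc j)) - w (suc j)))      ≡⟨ Σ≡0 ⟩
      0#                                                      ∎)

    -Y∷b∈Fq : ∀ j → InFq F q (((- Y) ∷ b) j)
    -Y∷b∈Fq zero    = InFq-neg (σ-fixed⇒InFq σY≡Y)
    -Y∷b∈Fq (suc j) = b∈Fq j

    -Y+Y≡0 : - Y * w zero + Y ≡ 0#
    -Y+Y≡0 = trans (cong (λ z → - Y * z + Y) w₀≡1) (trans (cong (_+ Y) (*-identityʳ (- Y))) (-‿inverseˡ Y))

  tailSums : ∀ {n} → (Fin (suc n) → Carrier) → Fin n → Carrier
  tailSums {suc n} c zero    = sumF F (suc n) (λ t → c (suc t))
  tailSums {suc n} c (suc i) = tailSums (λ t → c (suc t)) i

  summation-by-parts : ∀ n (c y : Fin (suc n) → Carrier) →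
    sumF F (suc n) (λ t → c t * y t) ≡
    sumF F n (λ i → tailSums c i * (y (suc i) - y (inject₁ i))) + sumF F (suc n) c * y zero
  summation-by-parts zero    c y =
    trans (+-identityʳ _) (sym (trans (+-identityˡ _) (cong (_* y zero) (+-identityʳ (c zero)))))
  summation-by-parts (suc n) c y = begin
    c zero * y zero + sumF F (suc n) (λ t → c′ t * y′ t)
      ≡⟨ cong (c zero * y zero +_) (summation-by-parts n c′ y′) ⟩
    c zero * y zero + (A + T * y′ zero)
      ≡⟨ cong (λ z → c zero * y zero + (A + T * z)) (x-y+y≡x (y′ zero) (y zero)) ⟨
    c zero * y zero + (A + T * (d + y zero))
      ≡⟨ summation-by-parts-step (c zero) (y zero) d A T ⟩
    (T * d + A) + (c zero + T) * y zero
      ∎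
    where
    c′ = λ t → c (suc t)
    y′ = λ t → y (suc t)
    A = sumF F n (λ i → tailSums c′ i * (y′ (suc i) - y′ (inject₁ i)))
    T = sumF F (suc n) c′
    d = y′ zero - y zero

  tailSums≡0⇒≡0 : ∀ n (c : Fin (suc n) → Carrier) →
    (∀ i → tailSums c i ≡ 0#) → sumF F (suc n) c ≡ 0# → ∀ t → c t ≡ 0#
  tailSums≡0⇒≡0 zero    c _       Σc≡0 zero    = trans (sym (+-identityʳ _)) Σc≡0
  tailSums≡0⇒≡0 (suc n) c tails≡0 Σc≡0 zero    = trans (sym (y≡0⇒x+y≡x (tails≡0 zero))) Σc≡0
  tailSums≡0⇒≡0 (suc n) c tails≡0 Σc≡0 (suc t) =
    tailSums≡0⇒≡0 n (λ i → c (suc i)) (λ i → tails≡0 (suc i)) (tails≡0 zero) t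

  linearized-by-parts : ∀ n (c : Fin (suc n) → Carrier) x →
    linearized (suc n) c x ≡ linearized n (tailSums c) (σ x - x) + sumF F (suc n) c * x
  linearized-by-parts n c x = begin
    linearized (suc n) c x
      ≡⟨ summation-by-parts n c (λ t → σ^ (toℕ t) x) ⟩
    sumF F n (λ i → tailSums c i * (σ^ (suc (toℕ i)) x - σ^ (toℕ (inject₁ i)) x)) + sumF F (suc n) c * σ^ 0 x
      ≡⟨ cong₂ _+_ (sumF-cong n (λ i → cong (tailSums c i *_) (difference i)))
                   (cong (sumF F (suc n) c *_) (σ^-zero x)) ⟩
    linearized n (tailSums c) (σ x - x) + sumF F (suc n) c * x
      ∎
    where
    difference : ∀ i → σ^ (suc (toℕ i)) x - σ^ (toℕ (inject₁ i)) x ≡ σ^ (toℕ i) (σ x - x)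
    difference i = begin
      σ^ (suc (toℕ i)) x - σ^ (toℕ (inject₁ i)) x
        ≡⟨ cong₂ _-_ (σ^-suc′ (toℕ i) x) (cong (λ t → σ^ t x) (Finₚ.toℕ-inject₁ i)) ⟩
      σ^ (toℕ i) (σ x) - σ^ (toℕ i) x
        ≡⟨ σ^-sub (toℕ i) (σ x) x ⟨
      σ^ (toℕ i) (σ x - x)
        ∎

  -- Normalise the first point to 1: then the coefficient sum is the value at 1, hence 0,
  -- and summation by parts leaves a relation for the n - 1 tail sums at the points
  -- σ w - w, which are again F_q-independent because the fixed field of σ is F_q.
  FqIndependent⇒σ-independent : ∀ n (v : Fin n → Carrier) → FqIndependent n v →
    ∀ c → (∀ j → linearized n c (v j) ≡ 0#) → ∀ t → c t ≡ 0#
  FqIndependent⇒σ-independent (suc n) v independent c vanishes t =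
    x≢0⇒x*y≡0⇒y≡0 (pow-≢0 (q ^ (s Nat.* toℕ t)) v₀≢0) (trans (*-comm _ (c t)) (ĉ≡0 t))
    where
    v₀ = v zero
    v₀≢0 : ¬ v₀ ≡ 0#
    v₀≢0 = FqIndependent-≢0 {v = v} independent zero
    a = inv v₀ v₀≢0

    w : Fin (suc n) → Carrier
    w j = v j * a

    w₀≡1 : w zero ≡ 1#
    w₀≡1 = x*inv≡1 v₀ v₀≢0

    ĉ : Fin (suc n) → Carrier
    ĉ t = c t * σ^ (toℕ t) v₀

    ĉ-vanishes : ∀ j → linearized (suc n) ĉ (w j) ≡ 0#
    ĉ-vanishes j = trans (sumF-cong (suc n) term) (vanishes j)
      where
      v₀*wⱼ≡vⱼ : v₀ * w j ≡ v j
      v₀*wⱼ≡vⱼ = trans (*-CS.x∙yz≈y∙xz v₀ (v j) a) (trans (cong (v j *_) w₀≡1) (*-identityʳ (v j)))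

      term : ∀ t → ĉ t * σ^ (toℕ t) (w j) ≡ c t * σ^ (toℕ t) (v j)
      term t = begin
        (c t * σ^ (toℕ t) v₀) * σ^ (toℕ t) (w j)  ≡⟨ *-assoc _ _ _ ⟩
        c t * (σ^ (toℕ t) v₀ * σ^ (toℕ t) (w j))  ≡⟨ cong (c t *_) (σ^-homo-* (toℕ t) v₀ (w j)) ⟨
        c t * σ^ (toℕ t) (v₀ * w j)               ≡⟨ cong (λ z → c t * σ^ (toℕ t) z) v₀*wⱼ≡vⱼ ⟩
        c t * σ^ (toℕ t) (v j)                    ∎

    Σĉ≡0 : sumF F (suc n) ĉ ≡ 0#
    Σĉ≡0 = begin
      sumF F (suc n) ĉ
        ≡⟨ sumF-cong (suc n) (λ t → trans (cong (ĉ t *_) (σ^-1# (toℕ t))) (*-identityʳ (ĉ t))) ⟨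
      linearized (suc n) ĉ 1#        ≡⟨ cong (linearized (suc n) ĉ) w₀≡1 ⟨
      linearized (suc n) ĉ (w zero)  ≡⟨ ĉ-vanishes zero ⟩
      0#                             ∎

    tails-vanish : ∀ j → linearized n (tailSums ĉ) (σ (w (suc j)) - w (suc j)) ≡ 0#
    tails-vanish j = trans (sym (y≡0⇒x+y≡x (x≡0⇒x*y≡0 (w (suc j)) Σĉ≡0)))
                           (trans (sym (linearized-by-parts n ĉ (w (suc j)))) (ĉ-vanishes (suc j)))

    ĉ≡0 : ∀ t → ĉ t ≡ 0#
    ĉ≡0 = tailSums≡0⇒≡0 n ĉ
      (FqIndependent⇒σ-independent n (λ j → σ (w (suc j)) - w (suc j))
        (FqIndependent-σ-differences {w = w} w₀≡1 (FqIndependent-scale {v = v} (inv-≢0 v₀ v₀≢0) independent))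
        (tailSums ĉ) tails-vanish)
      Σĉ≡0

  FqIndependent⇒σ-IndependentOn : ∀ {S : Carrier → Set} {n} {w : Fin n → Carrier} → FqIndependent n w →
    (∀ i → S (w i)) → σ-IndependentOn S n
  FqIndependent⇒σ-IndependentOn {n = n} {w} independent w∈S c vanishes =
    FqIndependent⇒σ-independent n w independent c (λ j → vanishes (w j) (w∈S j))

  HasFqDim⇒σ-IndependentOn : ∀ {S : Carrier → Set} {n k} → k ≤ n → HasFqDim F q S n → σ-IndependentOn S k
  HasFqDim⇒σ-IndependentOn {S} {n} {k} k≤n (v , v∈S , independent , _) =
    from-suffix (n Nat.∸ k) (ℕₚ.m∸n+n≡m k≤n) v independent v∈S
    where
    from-suffix : ∀ d {n} → d Nat.+ k ≡ n → (v : Fin n → Carrier) → FqIndependent n v → (∀ i → S (v i)) →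
      σ-IndependentOn S k
    from-suffix d refl v independent v∈S =
      FqIndependent⇒σ-IndependentOn {S} (FqIndependent-raise d {v = v} independent) (λ i → v∈S (d Fin.↑ʳ i))

  σ-independent-everywhere : ∀ {n} → n ≤ m → σ-IndependentOn (λ _ → ⊤) n
  σ-independent-everywhere {n} n≤m c vanishes =
    characters-independent n (λ t → σ^ (toℕ t)) σ^-isMonoidHomomorphism distinct c (λ x → vanishes x tt)
    where
    σ^-isMonoidHomomorphism : ∀ t → IsMonoidHomomorphism (σ^ (toℕ t))
    σ^-isMonoidHomomorphism t = record
      { isMagmaHomomorphism = record
        { isRelHomomorphism = record { cong = cong (σ^ (toℕ t)) }
        ; homo              = σ^-homo-* (toℕ t)
        }
      ; ε-homo = σ^-1# (toℕ t)
      }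

    distinct : ∀ a b → ¬ a ≡ b → ∃[ y ] ¬ σ^ (toℕ a) y ≡ σ^ (toℕ b) y
    distinct a b a≢b with ℕₚ.<-cmp (toℕ a) (toℕ b)
    ... | tri< a<b _ _ = σ^-distinct a<b (ℕₚ.<-≤-trans (Finₚ.toℕ<n b) n≤m)
    ... | tri≈ _ a≡b _ = ⊥-elim (a≢b (Finₚ.toℕ-injective a≡b))
    ... | tri> _ _ b<a with σ^-distinct b<a (ℕₚ.<-≤-trans (Finₚ.toℕ<n a) n≤m)
    ...   | y , σᵇy≢σᵃy = y , (λ eq → σᵇy≢σᵃy (sym eq))

  σ-IndependentOn⇒shift-coefficients : ∀ {S : Carrier → Set} {k} → σ-IndependentOn S (suc (suc k)) →
    (a b : Fin (suc k) → Carrier) →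
    (∀ x → S x → linearized (suc k) a x ≡ sumF F (suc k) (λ j → b j * σ^ (suc (toℕ j)) x)) →
    a zero ≡ 0# × b (fromℕ k) ≡ 0# × (∀ j → a (suc j) ≡ b (inject₁ j))
  σ-IndependentOn⇒shift-coefficients {S} {k} independent a b a≡shifted-b =
    x-y≡0⇒x≡y (c≡0 zero) ,
    sym (x-y≡0⇒x≡y (trans (cong (_- b (fromℕ k)) (sym (∷ʳ-fromℕ a 0#))) (c≡0 (fromℕ (suc k))))) ,
    (λ j → x-y≡0⇒x≡y (trans (cong (_- b (inject₁ j)) (sym (∷ʳ-inject₁ a 0# (suc j)))) (c≡0 (suc (inject₁ j)))))
    where
    c : Fin (suc (suc k)) → Carrier
    c t = (a ∷ʳ 0#) t - (0# ∷ b) t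

    c≡0 : ∀ t → c t ≡ 0#
    c≡0 = independent c c-vanishes
      where
      c-vanishes : ∀ x → S x → linearized (suc (suc k)) c x ≡ 0#
      c-vanishes x x∈S = begin
        linearized (suc (suc k)) c x
          ≡⟨ sumF-cong (suc (suc k)) (λ t → [y-z]x≈yx-zx (σ^ (toℕ t) x) ((a ∷ʳ 0#) t) ((0# ∷ b) t)) ⟩
        sumF F (suc (suc k)) (λ t → (a ∷ʳ 0#) t * σ^ (toℕ t) x - (0# ∷ b) t * σ^ (toℕ t) x)
          ≡⟨ sumF-distrib-sub (suc (suc k)) (λ t → (a ∷ʳ 0#) t * σ^ (toℕ t) x) (λ t → (0# ∷ b) t * σ^ (toℕ t) x) ⟩
        sumF F (suc (suc k)) (λ t → (a ∷ʳ 0#) t * σ^ (toℕ t) x) - (0# * σ^ 0 x + shifted)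
          ≡⟨ cong₂ _-_ (sumF-∷ʳ-0# (suc k) a (λ t → σ^ (toℕ t) x)) (y≡0⇒y+x≡x (zeroˡ (σ^ 0 x))) ⟩
        sumF F (suc k) (λ j → a j * σ^ (toℕ (inject₁ j)) x) - shifted
          ≡⟨ cong (_- shifted) (sumF-cong (suc k) (λ j → cong (λ t → a j * σ^ t x) (Finₚ.toℕ-inject₁ j))) ⟩
        linearized (suc k) a x - shifted
          ≡⟨ x≈y⇒x∙y⁻¹≈ε (a≡shifted-b x x∈S) ⟩
        0# ∎
        where shifted = sumF F (suc k) (λ j → b j * σ^ (suc (toℕ j)) x)

module ShiftStructuredMatrices (F : FiniteField) (σ : FiniteField.Carrier F → FiniteField.Carrier F)
                               (σ-0# : σ (FiniteField.0# F) ≡ FiniteField.0# F)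
                               (σ≡0⇒x≡0 : ∀ {x} → σ x ≡ FiniteField.0# F → x ≡ FiniteField.0# F) where
  open FieldProperties F

  record ShiftStructured {k} (A : Mat F (suc k)) : Set where
    field
      first-column : ∀ (i : Fin k) → A (suc i) zero ≡ 0#
      last-column  : ∀ (i : Fin k) → A (inject₁ i) (fromℕ k) ≡ 0#
      shift        : ∀ (i j : Fin k) → A (suc i) (suc j) ≡ σ (A (inject₁ i) (inject₁ j))

  -- The lower right block is again shift structured; its first row is zero by induction,
  -- which through the shift relation and σ x ≡ 0 ⇒ x ≡ 0 clears the first row of A.
  shiftStructured⇒diagonal : ∀ k (A : Mat F (suc k)) → ShiftStructured A →
    ∀ i j → A i j ≡ idM F i j * iterate σ (A zero zero) (toℕ i)
  shiftStructured⇒diagonal zero A _ zero zero = sym (trans (cong (_* A zero zero) (idM-diag {1} zero)) (*-identityˡ _))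
  shiftStructured⇒diagonal (suc k) A structured = entries
    where
    open ShiftStructured structured

    B : Mat F (suc k)
    B i j = A (suc i) (suc j)

    B-structured : ShiftStructured B
    B-structured = record
      { first-column = λ i → trans (shift (suc i) zero) (trans (cong σ (first-column (inject₁ i))) σ-0#)
      ; last-column  = λ i → last-column (suc i)
      ; shift        = λ i j → shift (suc i) (suc j)
      }

    B-diagonal : ∀ i j → B i j ≡ idM F i j * iterate σ (σ (A zero zero)) (toℕ i)
    B-diagonal i j = trans (shiftStructured⇒diagonal k B B-structured i j)
                           (cong (λ d → idM F i j * iterate σ d (toℕ i)) (shift zero zero))

    first-row : ∀ j → A zero (suc j) ≡ 0#
    first-row j with view j
    ... | ‵fromℕ      = last-column zero
    ... | ‵inject₁ j′ = σ≡0⇒x≡0 (trans (sym (shift zero (suc j′)))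
                          (trans (B-diagonal zero (suc j′)) (x≡0⇒x*y≡0 _ (idM-offdiag zero (suc j′) λ ()))))

    entries : ∀ i j → A i j ≡ idM F i j * iterate σ (A zero zero) (toℕ i)
    entries zero    zero    = sym (trans (cong (_* A zero zero) (idM-diag {suc (suc k)} zero)) (*-identityˡ _))
    entries zero    (suc j) = trans (first-row j) (sym (x≡0⇒x*y≡0 _ (idM-offdiag zero (suc j) λ ())))
    entries (suc i) zero    = trans (first-column i) (sym (x≡0⇒x*y≡0 _ (idM-offdiag (suc i) zero λ ())))
    entries (suc i) (suc j) = trans (B-diagonal i j) (cong (_* _) (sym (idM-suc i j)))

module MatrixProperties (F : FiniteField) where
  open FieldProperties F
  open ≡-Reasoning

  ·v-resp-≐M : ∀ {k} {A B : Mat F k} → _≐M_ F A B → ∀ u i → _·v_ F A u i ≡ _·v_ F B u i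
  ·v-resp-≐M {k} A≐B u i = sumF-cong k (λ j → cong (_* u j) (A≐B i j))

  IsInvertible-resp-≐M : ∀ {k} {A B : Mat F k} → _≐M_ F A B → IsInvertible F B → IsInvertible F A
  IsInvertible-resp-≐M {k} A≐B (C , BC≐I , CB≐I) = C ,
    (λ i j → trans (sumF-cong k (λ l → cong (_* C l j) (A≐B i l))) (BC≐I i j)) ,
    (λ i j → trans (sumF-cong k (λ l → cong (C i l *_) (A≐B l j))) (CB≐I i j))

  MapsOnto-resp-≐M : ∀ {k} {A B : Mat F k} {U V} → _≐M_ F A B → MapsOnto F B U V → MapsOnto F A U V
  MapsOnto-resp-≐M A≐B B-maps v = mk⇔
    (λ v∈V → let (u , u∈U , Bu≐v) = Equivalence.to (B-maps v) v∈V in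
             u , u∈U , (λ i → trans (·v-resp-≐M A≐B u i) (Bu≐v i)))
    (λ (u , u∈U , Au≐v) → Equivalence.from (B-maps v) (u , u∈U , (λ i → trans (sym (·v-resp-≐M A≐B u i)) (Au≐v i))))

  invertible⇒row≢0 : ∀ {k} {A : Mat F k} → IsInvertible F A → ∀ i → ¬ (∀ j → A i j ≡ 0#)
  invertible⇒row≢0 {k} {A} (B , AB≐I , _) i rowᵢ≡0 = 1≢0 (begin
    1#                                  ≡⟨ idM-diag i ⟨
    idM F i i                           ≡⟨ AB≐I i i ⟨
    sumF F k (λ l → A i l * B l i)      ≡⟨ sumF-zero k (λ l → trans (cong (_* B l i) (rowᵢ≡0 l)) (zeroˡ _)) ⟩
    0#                                  ∎)

module GabidulinSystems (F : FiniteField) {p e m : ℕ} (p-prime : Prime p) (1≤e : 1 ≤ e)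
                        (size≡qᵐ : FiniteField.size F ≡ (p ^ e) ^ m) (s : ℕ) (gcd[s,m]≡1 : gcd s m ≡ 1) where
  open FieldProperties F
  open MatrixProperties F
  open Frobenius F p-prime 1≤e size≡qᵐ s gcd[s,m]≡1
  open LinearizedPolynomials F p-prime 1≤e size≡qᵐ s gcd[s,m]≡1
  open ShiftStructuredMatrices F σ σ-0# σ≡0⇒x≡0
  open ≡-Reasoning

  gab : ∀ {k} → Carrier → Vec F k
  gab x i = σ^ (toℕ i) x

  iterate-σ≡σ^ : ∀ t x → iterate σ x t ≡ σ^ t x
  iterate-σ≡σ^ zero    x = sym (σ^-zero x)
  iterate-σ≡σ^ (suc t) x = trans (iterate-σ≡σ^ t (σ x)) (sym (σ^-suc′ t x))

  diagFrob-·v : ∀ {k} d (u : Vec F k) i → _·v_ F (diagFrob F q k s d) u i ≡ σ^ (toℕ i) d * u i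
  diagFrob-·v {k} d u i = begin
    sumF F k (λ j → (idM F i j * σ^ (toℕ i) d) * u j)   ≡⟨ sumF-cong k (λ j → *-CS.xy∙z≈y∙xz _ _ (u j)) ⟩
    sumF F k (λ j → σ^ (toℕ i) d * (idM F i j * u j))   ≡⟨ *-distribˡ-sumF k (σ^ (toℕ i) d) _ ⟨
    σ^ (toℕ i) d * sumF F k (λ j → idM F i j * u j)     ≡⟨ cong (σ^ (toℕ i) d *_) (sumF-idM k i u) ⟩
    σ^ (toℕ i) d * u i                                  ∎

  diagFrob-·M : ∀ {k} d d′ → _≐M_ F (_·M_ F (diagFrob F q k s d) (diagFrob F q k s d′)) (diagFrob F q k s (d * d′))
  diagFrob-·M {k} d d′ i j = begin
    sumF F k (λ l → diagFrob F q k s d i l * diagFrob F q k s d′ l j)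
      ≡⟨ diagFrob-·v d (λ l → diagFrob F q k s d′ l j) i ⟩
    σ^ (toℕ i) d * (idM F i j * σ^ (toℕ i) d′)
      ≡⟨ *-CS.x∙yz≈y∙xz _ _ _ ⟩
    idM F i j * (σ^ (toℕ i) d * σ^ (toℕ i) d′)
      ≡⟨ cong (idM F i j *_) (σ^-homo-* (toℕ i) d d′) ⟨
    idM F i j * σ^ (toℕ i) (d * d′)
      ∎

  diagFrob-invertible : ∀ {k d} → ¬ d ≡ 0# → IsInvertible F (diagFrob F q k s d)
  diagFrob-invertible {k} {d} d≢0 = diagFrob F q k s (inv d d≢0) ,
    (λ i j → trans (diagFrob-·M d _ i j) (diagFrob-1# (x*inv≡1 d d≢0) i j)) ,
    (λ i j → trans (diagFrob-·M _ d i j) (diagFrob-1# (inv*x≡1 d d≢0) i j))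
    where
    diagFrob-1# : ∀ {c} → c ≡ 1# → _≐M_ F (diagFrob F q k s c) (idM F)
    diagFrob-1# refl i j = trans (cong (idM F i j *_) (σ^-1# (toℕ i))) (*-identityʳ _)

  diagFrob-maps : ∀ {k d S T} → IsScaled F d S T → MapsOnto F (diagFrob F q k s d) (Gab F q k s S) (Gab F q k s T)
  diagFrob-maps {k} {d} {S} {T} T≡dS v = mk⇔
    (λ (y , y∈T , v≐gab-y) → let (x , x∈S , y≡dx) = Equivalence.to (T≡dS y) y∈T in
      gab x , (x , x∈S , λ _ → refl) , λ i → begin
        _·v_ F (diagFrob F q k s d) (gab x) i  ≡⟨ diagFrob-·v d (gab x) i ⟩
        σ^ (toℕ i) d * σ^ (toℕ i) x            ≡⟨ σ^-homo-* (toℕ i) d x ⟨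
        σ^ (toℕ i) (d * x)                     ≡⟨ cong (σ^ (toℕ i)) y≡dx ⟨
        σ^ (toℕ i) y                           ≡⟨ v≐gab-y i ⟨
        v i                                    ∎)
    (λ (u , (x , x∈S , u≐gab-x) , Du≐v) →
      d * x , Equivalence.from (T≡dS (d * x)) (x , x∈S , refl) , λ i → begin
        v i                                    ≡⟨ Du≐v i ⟨
        _·v_ F (diagFrob F q k s d) u i        ≡⟨ diagFrob-·v d u i ⟩
        σ^ (toℕ i) d * u i                     ≡⟨ cong (σ^ (toℕ i) d *_) (u≐gab-x i) ⟩
        σ^ (toℕ i) d * σ^ (toℕ i) x            ≡⟨ σ^-homo-* (toℕ i) d x ⟨
        σ^ (toℕ i) (d * x)                     ∎)

  module Rigidity {k} {S T : Carrier → Set} (independent : σ-IndependentOn S (suc (suc k)))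
                  (A : Mat F (suc k)) (A-maps : MapsOnto F A (Gab F q (suc k) s S) (Gab F q (suc k) s T)) where

    image : ∀ x → S x → Gab F q (suc k) s T (_·v_ F A (gab x))
    image x x∈S = Equivalence.from (A-maps (_·v_ F A (gab x))) (gab x , (x , x∈S , λ _ → refl) , λ _ → refl)

    row-shift : ∀ (i : Fin k) x → S x → _·v_ F A (gab x) (suc i) ≡ σ (_·v_ F A (gab x) (inject₁ i))
    row-shift i x x∈S with image x x∈S
    ... | y , _ , Agab-x≐gab-y = begin
      _·v_ F A (gab x) (suc i)              ≡⟨ Agab-x≐gab-y (suc i) ⟩
      σ^ (suc (toℕ i)) y                    ≡⟨ σ^-suc (toℕ i) y ⟩
      σ (σ^ (toℕ i) y)                      ≡⟨ cong (λ t → σ (σ^ t y)) (Finₚ.toℕ-inject₁ i) ⟨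
      σ (σ^ (toℕ (inject₁ i)) y)            ≡⟨ cong σ (Agab-x≐gab-y (inject₁ i)) ⟨
      σ (_·v_ F A (gab x) (inject₁ i))      ∎

    structured : ShiftStructured A
    structured = record
      { first-column = λ i → proj₁ (coefficients i)
      ; last-column  = λ i → σ≡0⇒x≡0 (proj₁ (proj₂ (coefficients i)))
      ; shift        = λ i j → proj₂ (proj₂ (coefficients i)) j
      }
      where
      coefficients : ∀ i → A (suc i) zero ≡ 0# × σ (A (inject₁ i) (fromℕ k)) ≡ 0# ×
                           (∀ j → A (suc i) (suc j) ≡ σ (A (inject₁ i) (inject₁ j)))
      coefficients i = σ-IndependentOn⇒shift-coefficients independent (A (suc i)) (λ j → σ (A (inject₁ i) j)) relation
        where
        relation : ∀ x → S x → _·v_ F A (gab x) (suc i) ≡ sumF F (suc k) (λ j → σ (A (inject₁ i) j) * σ^ (suc (toℕ j)) x)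
        relation x x∈S = begin
          _·v_ F A (gab x) (suc i)
            ≡⟨ row-shift i x x∈S ⟩
          σ (sumF F (suc k) (λ j → A (inject₁ i) j * σ^ (toℕ j) x))
            ≡⟨ σ-homo-sumF (suc k) (λ j → A (inject₁ i) j * σ^ (toℕ j) x) ⟩
          sumF F (suc k) (λ j → σ (A (inject₁ i) j * σ^ (toℕ j) x))
            ≡⟨ sumF-cong (suc k) term ⟩
          sumF F (suc k) (λ j → σ (A (inject₁ i) j) * σ^ (suc (toℕ j)) x)
            ∎
          where
          term : ∀ j → σ (A (inject₁ i) j * σ^ (toℕ j) x) ≡ σ (A (inject₁ i) j) * σ^ (suc (toℕ j)) x
          term j = trans (pow-distrib-* _ _ (q ^ s)) (cong (σ (A (inject₁ i) j) *_) (sym (σ^-suc (toℕ j) x)))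

    d = A zero zero

    diagonal : _≐M_ F A (diagFrob F q (suc k) s d)
    diagonal i j = trans (shiftStructured⇒diagonal k A structured i j) (cong (idM F i j *_) (iterate-σ≡σ^ (toℕ i) d))

    first-entry : ∀ u → _·v_ F A u zero ≡ d * u zero
    first-entry u =
      trans (·v-resp-≐M {A = A} diagonal u zero) (trans (diagFrob-·v d u zero) (cong (_* u zero) (σ^-zero d)))

    d≢0 : IsInvertible F A → ¬ d ≡ 0#
    d≢0 A-invertible d≡0 = invertible⇒row≢0 {A = A} A-invertible zero λ j →
      trans (diagonal zero j) (trans (cong (idM F zero j *_) (trans (σ^-zero d) d≡0)) (zeroʳ _))

    scaled : IsScaled F d S T
    scaled y = mk⇔
      (λ y∈T → let (u , (x , x∈S , u≐gab-x) , Au≐gab-y) = Equivalence.to (A-maps (gab y)) (y , y∈T , λ _ → refl) in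
        x , x∈S , (begin
          y                     ≡⟨ σ^-zero y ⟨
          σ^ 0 y                ≡⟨ Au≐gab-y zero ⟨
          _·v_ F A u zero       ≡⟨ first-entry u ⟩
          d * u zero            ≡⟨ cong (d *_) (trans (u≐gab-x zero) (σ^-zero x)) ⟩
          d * x                 ∎))
      (λ (x , x∈S , y≡dx) → let (y′ , y′∈T , Agab-x≐gab-y′) = image x x∈S in
        subst T (begin
          y′                    ≡⟨ σ^-zero y′ ⟨
          σ^ 0 y′               ≡⟨ Agab-x≐gab-y′ zero ⟨
          _·v_ F A (gab x) zero ≡⟨ first-entry (gab x) ⟩
          d * σ^ 0 x            ≡⟨ cong (d *_) (σ^-zero x) ⟩
          d * x                 ≡⟨ y≡dx ⟨
          y                     ∎) y′∈T)

  equivalent⇔scaled : ∀ {k} {S T : Carrier → Set} → σ-IndependentOn S (suc (suc k)) →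
    Equivalent F (Gab F q (suc k) s S) (Gab F q (suc k) s T) ⇔ (∃[ α ] (¬ (α ≡ 0#) × IsScaled F α S T))
  equivalent⇔scaled independent = mk⇔
    (λ (A , A-invertible , A-maps) → let open Rigidity independent A A-maps in d , d≢0 A-invertible , scaled)
    (λ (α , α≢0 , T≡αS) → diagFrob F q _ s α , diagFrob-invertible α≢0 , diagFrob-maps T≡αS)

  stabilizer⇔diagFrob : ∀ {k} → σ-IndependentOn (λ _ → ⊤) (suc (suc k)) → (A : Mat F (suc k)) →
    InStab F (GabFull F q (suc k) s) A ⇔ (∃[ d ] (¬ (d ≡ 0#) × _≐M_ F A (diagFrob F q (suc k) s d)))
  stabilizer⇔diagFrob independent A = mk⇔
    (λ (A-invertible , A-maps) → let open Rigidity independent A A-maps in d , d≢0 A-invertible , diagonal)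
    (λ (d , d≢0 , A≐D) → IsInvertible-resp-≐M {A = A} A≐D (diagFrob-invertible d≢0) ,
                         MapsOnto-resp-≐M {A = A} A≐D (diagFrob-maps (everything-scaled d≢0)))
    where
    everything-scaled : ∀ {d} → ¬ d ≡ 0# → IsScaled F d (λ _ → ⊤) (λ _ → ⊤)
    everything-scaled {d} d≢0 y = mk⇔
      (λ _ → inv d d≢0 * y , tt , sym (x*[inv*y]≡y d≢0 y))
      (λ _ → tt)

theorem4p3 : (q m k s : ℕ) → IsPrimePower q → 1 ≤ m → 1 ≤ k
    → 1 ≤ s → s ≤ m → gcd s m ≡ 1
    → (F : FiniteField) → FiniteField.size F ≡ q ^ m
    → ((S T : FiniteField.Carrier F → Set)
        → IsFqSubspace F q S → IsFqSubspace F q T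
        → (∃[ n ] (k < n × HasFqDim F q S n × HasFqDim F q T n))
        → Equivalent F (Gab F q k s S) (Gab F q k s T)
          ⇔ (∃[ α ] (¬ (α ≡ FiniteField.0# F) × IsScaled F α S T)))
      × (k < m
        → (A : Mat F k)
        → InStab F (GabFull F q k s) A
          ⇔ (∃[ d ] (¬ (d ≡ FiniteField.0# F) × _≐M_ F A (diagFrob F q k s d))))
theorem4p3 q m (suc k) s (p , e , p-prime , 1≤e , refl) _ _ _ _ gcd[s,m]≡1 F size≡qᵐ =
    (λ S T _ _ (n , k<n , S-dim , _) → equivalent⇔scaled (HasFqDim⇒σ-IndependentOn k<n S-dim))
  , (λ k<m A → stabilizer⇔diagFrob (σ-independent-everywhere k<m) A)
  where
  open LinearizedPolynomials F p-prime 1≤e size≡qᵐ s gcd[s,m]≡1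
  open GabidulinSystems F p-prime 1≤e size≡qᵐ s gcd[s,m]≡1
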